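{- Let $A=\{z_1,z_2,\dots\}$ be the set of letters $z_j$, one for each natural number $j$, let $\mathbb{Q}A$ be the $\mathbb{Q}$-vector space spanned by these letters and $\mathbb{Q}\langle A\rangle$ the noncommutative polynomial algebra over $\mathbb{Q}$ generated by words in $A$. Equip $\mathbb{Q}\langle A\rangle$ with the quasi-shuffle product $*$ defined recursively by $1*w=w*1=w$ and \[ aw * bv = a(w * bv) + b(aw * v) + (a\diamond b)(w * v) \qquad (a,b\in A,\ w,v\in \mathbb{Q}\langle A\rangle),\] where $\diamond$ is the commutative, associative product on $\mathbb{Q}A$ given by \[ z_a\diamond z_b = \sum_{j=1}^a \lambda^j_{a,b} z_j + \sum_{j=1}^b \lambda^j_{b,a} z_j + z_{a+b},\qquad \lambda^j_{a,b}=(-1)^{b-1}\binom{a+b-j-1}{a-j}\frac{B_{a+b-j}}{(a+b-j)!},\] with $B_n$ the Bernoulli numbers. Let $\mathcal{MD}$ be the $\mathbb{Q}$-vector space spanned by $1$ and all brackets \[ [s_1,\dots,s_l] = \frac{1}{(s_1-1)!\cdots(s_l-1)!}\sum_{n>0}\sigma_{s_1-1,\dots,s_l-1}(n)q^n\in\mathbb{Q}[[q]],\qquad \sigma_{r_1,\dots,r_l}(n)=\sum_{\substack{u_1v_1+\dots+u_lv_l=n\\ u_1>\dots>u_l>0}} v_1^{r_1}\cdots v_l^{r_l},\] with the ordinary product of power series. Then the linear map $[\,.\,]:(\mathbb{Q}\langle A\rangle,*)\to(\mathcal{MD},\cdot)$ defined on words $w=z_{s_1}\dots z_{s_l}$ by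 $[w]:=[s_1,\dots,s_l]$ satisfies \[ [w * v] = [w]\cdot[v], \] and therefore $\mathcal{MD}$ is a $\mathbb{Q}$-algebra and $[\,.\,]$ is an algebra homomorphism.
   Context: Brackets are generating functions of multiple divisor sums; $(\mathbb{Q}\langle A\rangle,*)$ is a commutative $\mathbb{Q}$-algebra by Hoffman–Ihara's theory of quasi-shuffle algebras. -}

module Defs where

open import Data.Nat as ℕ using (ℕ; zero; suc; _∸_; _!; _≤ᵇ_)
open import Data.Nat.Properties using (_!≢0)
open import Data.Nat.Combinatorics using (_C_)
open import Data.Integer using (+_)
open import Data.Rational using (ℚ; 0ℚ; 1ℚ; _+_; _*_; -_; _/_)
open import Data.List using (List; []; _∷_; map; _++_; concatMap; foldr; upTo; downFrom; zip)
open import Data.Product using (_×_; _,_)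
open import Data.Bool using (if_then_else_)

sumℚ : List ℚ → ℚ
sumℚ = foldr _+_ 0ℚ

sumℕ : List ℕ → ℕ
sumℕ = foldr ℕ._+_ 0

range1 : ℕ → List ℕ
range1 n = map suc (upTo n)

signℚ : ℕ → ℚ
signℚ zero = 1ℚ
signℚ (suc k) = - signℚ k

invFact : ℕ → ℚ
invFact m = _/_ (+ 1) (m !) {{m !≢0}}

-- Bernoulli numbers (convention B₁ = -1/2), via the recursion
--   B₀ = 1,  B_{n+1} = -1/(n+2) · Σ_{k=0}^{n} C(n+2,k) B_k.
-- bernRev n = B_n ∷ B_{n-1} ∷ … ∷ B_0
bernRev : ℕ → List ℚ
bernRev zero = 1ℚ ∷ []
bernRev (suc n) =
  (- ((+ 1) / (suc (suc n))) *
      sumℚ (map (λ { (k , b) → ((+ (suc (suc n) C k)) / 1) * b })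
                (zip (downFrom (suc n)) (bernRev n))))
  ∷ bernRev n

bernoulli : ℕ → ℚ
bernoulli n with bernRev n
... | b ∷ _ = b
... | [] = 0ℚ

-- Words over A = {z₁, z₂, …}: the letter z_j is represented by j (j ≥ 1).
Word : Set
Word = List ℕ

-- Elements of ℚ⟨A⟩ as formal linear combinations of words,
-- elements of ℚA as formal linear combinations of letters.
LC : Set
LC = List (ℚ × Word)

LCA : Set
LCA = List (ℚ × ℕ)

lam : ℕ → ℕ → ℕ → ℚ
lam j a b =
  signℚ (b ∸ 1) * ((+ ((ℕ._+_ a b ∸ j ∸ 1) C (a ∸ j))) / 1)
    * bernoulli (ℕ._+_ a b ∸ j) * invFact (ℕ._+_ a b ∸ j)

_⋄_ : ℕ → ℕ → LCA
a ⋄ b = map (λ j → (lam j a b , j)) (range1 a)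
     ++ map (λ j → (lam j b a , j)) (range1 b)
     ++ ((1ℚ , ℕ._+_ a b) ∷ [])

prefix : ℕ → LC → LC
prefix a = map (λ { (c , u) → (c , a ∷ u) })

letterTimes : LCA → LC → LC
letterTimes ls x = concatMap (λ { (c , l) → map (λ { (d , u) → (c * d , l ∷ u) }) x }) ls

_⋆_ : Word → Word → LC
[] ⋆ v = (1ℚ , v) ∷ []
(a ∷ w) ⋆ [] = (1ℚ , a ∷ w) ∷ []
(a ∷ w) ⋆ (b ∷ v) =
  prefix a (w ⋆ (b ∷ v)) ++ prefix b ((a ∷ w) ⋆ v) ++ letterTimes (a ⋄ b) (w ⋆ v)

Series : Set
Series = ℕ → ℚ

_·_ : Series → Series → Series
(f · g) n = sumℚ (map (λ k → f k * g (n ∸ k)) (upTo (suc n)))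

-- sigma' rs n ub = Σ over u₁ > … > u_l > 0 with ub > u₁, v_i ≥ 1,
--   u₁v₁ + … + u_l v_l = n, of v₁^{r₁} ⋯ v_l^{r_l}
-- (nested finite sum, first letter gets the largest u)
sigma' : List ℕ → ℕ → ℕ → ℕ
sigma' [] n ub = if n ≤ᵇ 0 then 1 else 0
sigma' (r ∷ rs) n ub =
  sumℕ (map (λ u → sumℕ (map (λ v →
           if ℕ._*_ u v ≤ᵇ n then ℕ._*_ (v ℕ.^ r) (sigma' rs (n ∸ ℕ._*_ u v) u) else 0)
         (range1 n))) (range1 (ub ∸ 1)))

sigma : List ℕ → ℕ → ℕ
sigma rs n = sigma' rs n (suc n)

bracket : Word → Series
bracket [] zero = 1ℚ
bracket [] (suc n) = 0ℚ
bracket (s ∷ ss) zero = 0ℚ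
bracket (s ∷ ss) (suc n) =
  foldr (λ t acc → invFact (t ∸ 1) * acc) 1ℚ (s ∷ ss)
    * ((+ sigma (map (_∸ 1) (s ∷ ss)) (suc n)) / 1)

bracketLC : LC → Series
bracketLC x n = sumℚ (map (λ { (c , u) → c * bracket u n }) x)

module Submission where

-- Write L_s(q) = Σ_{v>0} v^{s−1}/(s−1)! qᵛ, so that [s₁,…,s_l] is the sum over u₁ > ⋯ > u_l > 0
-- of L_{s₁}(q^{u₁}) ⋯ L_{s_l}(q^{u_l}). Cutting the sum off at u₁ ≤ N gives truncated brackets with
-- [s w]_{≤N} = [s w]_{≤N−1} + L_s(q^N) · [w]_{≤N−1}, and the quasi-shuffle relation for them follows
-- by induction on N and on the words from the single identity
--   L_a · L_b = Σ_j λ^j_{a,b} L_j + Σ_j λ^j_{b,a} L_j + L_{a+b},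
-- which survives the substitution q ↦ q^N. Comparing coefficients of q^m, it is an identity for the
-- convolutions Σ_{v₁+v₂=m} v₁^{a−1} v₂^{b−1}: both sides satisfy the same recurrence in b, and for b = 1
-- it is Faulhaber's formula for power sums, which rests on B(x)(eˣ − 1)/x = 1 and B(x)eˣ = B(−x)
-- for B(x) = Σ_t B_t xᵗ/t!. Finally, [w]_{≤N} agrees with [w] up to degree N.

open import Defs
open import Data.Nat as ℕ using (ℕ; zero; suc; _∸_; _≤_; _<_; s≤s; _!; _^_; _≤ᵇ_; NonZero)
import Data.Nat.Properties as ℕP
open import Data.Nat.Properties using (_!≢0; _!*_!≢0)
open import Data.Nat.Combinatorics using (_C_; nCk≡n!/k![n-k]!; k![n∸k]!∣n!; nCk≡nC[n∸k]; nC1≡n; nCn≡1)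
open import Data.Nat.DivMod using (m/n*n≡m)
open import Data.Nat.Solver using () renaming (module +-*-Solver to ℕ-Solver)
import Data.Integer as ℤ
open import Data.Integer.GCD using (gcd)
import Data.Integer.Properties as ℤP
open import Data.Rational using (ℚ; 0ℚ; 1ℚ; _+_; _*_; -_; _-_; _/_; toℚᵘ; ↥_; ↧_)
open import Data.Rational.Properties
import Data.Rational.Unnormalised as ℚᵘ
import Data.Rational.Unnormalised.Properties as ℚᵘP
open import Data.Rational.Solver using (module +-*-Solver)
open import Algebra.Properties.Group +-0-group using () renaming (∙-cancelˡ to +-cancelˡ)
open import Data.List using (List; []; _∷_; _++_; map; foldr; upTo; applyUpTo; downFrom; zip)
open import Data.List.Relation.Unary.All using (All; _∷_)
open import Data.Product using (_×_; _,_)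
open import Data.Bool using (true; false; if_then_else_) renaming (T to True)
open import Data.Sum using (inj₁; inj₂)
open import Data.Unit using (tt)
open import Data.Empty using (⊥-elim)
open import Relation.Nullary using (Dec; yes; no)
open import Function using (_∘_)
open import Relation.Binary.PropositionalEquality
open ≡-Reasoning
open +-*-Solver
open ℕ-Solver using () renaming (solve to solveℕ; con to conℕ; _:+_ to _:+ℕ_; _:=_ to _:=ℕ_)

fromℕ : ℕ → ℚ
fromℕ zero = 0ℚ
fromℕ (suc n) = 1ℚ + fromℕ n

fromℕ-+ : ∀ m n → fromℕ (m ℕ.+ n) ≡ fromℕ m + fromℕ n
fromℕ-+ zero n = sym (+-identityˡ (fromℕ n))
fromℕ-+ (suc m) n = trans (cong (1ℚ +_) (fromℕ-+ m n)) (sym (+-assoc 1ℚ (fromℕ m) (fromℕ n)))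

fromℕ-* : ∀ m n → fromℕ (m ℕ.* n) ≡ fromℕ m * fromℕ n
fromℕ-* zero n = sym (*-zeroˡ (fromℕ n))
fromℕ-* (suc m) n = begin
  fromℕ (n ℕ.+ m ℕ.* n)         ≡⟨ fromℕ-+ n (m ℕ.* n) ⟩
  fromℕ n + fromℕ (m ℕ.* n)     ≡⟨ cong (fromℕ n +_) (fromℕ-* m n) ⟩
  fromℕ n + fromℕ m * fromℕ n   ≡⟨ solve 2 (λ a b → a :+ b :* a := (con 1ℚ :+ b) :* a) refl (fromℕ n) (fromℕ m) ⟩
  (1ℚ + fromℕ m) * fromℕ n      ∎

fromℕ-∸ : ∀ m n → n ≤ m → fromℕ (m ∸ n) ≡ fromℕ m - fromℕ n
fromℕ-∸ m zero _ = sym (+-identityʳ (fromℕ m))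
fromℕ-∸ (suc m) (suc n) (s≤s n≤m) = begin
  fromℕ (m ∸ n)                 ≡⟨ fromℕ-∸ m n n≤m ⟩
  fromℕ m - fromℕ n             ≡⟨ solve 2 (λ a b → a :- b := (con 1ℚ :+ a) :- (con 1ℚ :+ b)) refl (fromℕ m) (fromℕ n) ⟩
  fromℕ (suc m) - fromℕ (suc n) ∎

fromℕ-1 : fromℕ 1 ≡ 1ℚ
fromℕ-1 = +-identityʳ 1ℚ

-- ℚ's _/_ normalises by a gcd, so identities involving it are proved in the unnormalised rationals.
toℚᵘ-fromℕ : ∀ k → toℚᵘ (fromℕ k) ℚᵘ.≃ ℚᵘ.mkℚᵘ (ℤ.+ k) 0
toℚᵘ-fromℕ zero = ℚᵘ.*≡* refl
toℚᵘ-fromℕ (suc k) = ℚᵘP.≃-trans (toℚᵘ-homo-+ 1ℚ (fromℕ k))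
  (ℚᵘP.≃-trans (ℚᵘP.+-cong {toℚᵘ 1ℚ} {ℚᵘ.mkℚᵘ (ℤ.+ 1) 0} (ℚᵘ.*≡* refl) (toℚᵘ-fromℕ k))
    (ℚᵘ.*≡* (trans (ℤP.*-identityʳ _) (trans (cong (λ z → ℤ.+ 1 ℤ.+ z) (ℤP.*-identityʳ (ℤ.+ k))) (sym (ℤP.*-identityʳ _))))))

toℚᵘ-≃-scaled : ∀ (p : ℚ) i m g → ↥ p ℤ.* g ≡ i → ↧ p ℤ.* g ≡ ℤ.+ suc m → toℚᵘ p ℚᵘ.≃ ℚᵘ.mkℚᵘ i m
toℚᵘ-≃-scaled p@record{} i m g num den = ℚᵘ.*≡* (begin
  ↥ p ℤ.* ℤ.+ suc m        ≡⟨ cong (↥ p ℤ.*_) den ⟨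
  ↥ p ℤ.* (↧ p ℤ.* g)      ≡⟨ cong (↥ p ℤ.*_) (ℤP.*-comm (↧ p) g) ⟩
  ↥ p ℤ.* (g ℤ.* ↧ p)      ≡⟨ ℤP.*-assoc (↥ p) g (↧ p) ⟨
  (↥ p ℤ.* g) ℤ.* ↧ p      ≡⟨ cong (ℤ._* ↧ p) num ⟩
  i ℤ.* ↧ p                ∎)

toℚᵘ-/ : ∀ i n .{{_ : NonZero n}} → toℚᵘ (i / n) ℚᵘ.≃ ℚᵘ.mkℚᵘ i (n ∸ 1)
toℚᵘ-/ i (suc n) = toℚᵘ-≃-scaled (i / suc n) i n (gcd i (ℤ.+ suc n)) (↥-/ i (suc n)) (↧-/ i (suc n))

[k/n]*n≡k : ∀ k n .{{_ : NonZero n}} → (ℤ.+ k / n) * fromℕ n ≡ fromℕ k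
[k/n]*n≡k k (suc n) = toℚᵘ-injective (ℚᵘP.≃-trans (toℚᵘ-homo-* (ℤ.+ k / suc n) (fromℕ (suc n)))
  (ℚᵘP.≃-trans (ℚᵘP.*-cong (toℚᵘ-/ (ℤ.+ k) (suc n)) (toℚᵘ-fromℕ (suc n)))
  (ℚᵘP.≃-trans (ℚᵘ.*≡* eq) (ℚᵘP.≃-sym (toℚᵘ-fromℕ k)))))
  where
  eq : (ℤ.+ k ℤ.* ℤ.+ suc n) ℤ.* ℤ.+ 1 ≡ ℤ.+ k ℤ.* ℤ.+ (suc n ℕ.* 1)
  eq = trans (ℤP.*-identityʳ _) (cong (λ x → ℤ.+ k ℤ.* ℤ.+ x) (sym (ℕP.*-identityʳ (suc n))))

k/1≡fromℕ : ∀ k → ℤ.+ k / 1 ≡ fromℕ k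
k/1≡fromℕ k = trans (sym (*-identityʳ (ℤ.+ k / 1))) ([k/n]*n≡k k 1)

*-cancelˡ-fromℕ-suc : ∀ n {x y} → fromℕ (suc n) * x ≡ fromℕ (suc n) * y → x ≡ y
*-cancelˡ-fromℕ-suc n {x} {y} eq = begin
  x                                ≡⟨ *-identityˡ x ⟨
  1ℚ * x                           ≡⟨ cong (_* x) inverse ⟨
  1/n * fromℕ (suc n) * x          ≡⟨ *-assoc 1/n _ x ⟩
  1/n * (fromℕ (suc n) * x)        ≡⟨ cong (1/n *_) eq ⟩
  1/n * (fromℕ (suc n) * y)        ≡⟨ *-assoc 1/n _ y ⟨
  1/n * fromℕ (suc n) * y          ≡⟨ cong (_* y) inverse ⟩
  1ℚ * y                           ≡⟨ *-identityˡ y ⟩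
  y                                ∎
  where
  1/n = ℤ.+ 1 / suc n
  inverse : 1/n * fromℕ (suc n) ≡ 1ℚ
  inverse = [k/n]*n≡k 1 (suc n)

invFact*fromℕ! : ∀ m → invFact m * fromℕ (m !) ≡ 1ℚ
invFact*fromℕ! m = [k/n]*n≡k 1 (m !) {{m !≢0}}

fromℕ!*invFact : ∀ m → fromℕ (m !) * invFact m ≡ 1ℚ
fromℕ!*invFact m = trans (*-comm (fromℕ (m !)) (invFact m)) (invFact*fromℕ! m)

invFact-suc : ∀ m → invFact (suc m) * fromℕ (suc m) ≡ invFact m
invFact-suc m = begin
  x                                        ≡⟨ *-identityʳ x ⟨
  x * 1ℚ                                   ≡⟨ cong (x *_) (fromℕ!*invFact m) ⟨
  x * (fromℕ (m !) * invFact m)            ≡⟨ *-assoc x _ _ ⟨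
  x * fromℕ (m !) * invFact m              ≡⟨ cong (_* invFact m) x*m!≡1 ⟩
  1ℚ * invFact m                           ≡⟨ *-identityˡ _ ⟩
  invFact m                                ∎
  where
  x = invFact (suc m) * fromℕ (suc m)
  x*m!≡1 : x * fromℕ (m !) ≡ 1ℚ
  x*m!≡1 = begin
    invFact (suc m) * fromℕ (suc m) * fromℕ (m !)   ≡⟨ *-assoc (invFact (suc m)) _ _ ⟩
    invFact (suc m) * (fromℕ (suc m) * fromℕ (m !)) ≡⟨ cong (invFact (suc m) *_) (fromℕ-* (suc m) (m !)) ⟨
    invFact (suc m) * fromℕ (suc m !)               ≡⟨ invFact*fromℕ! (suc m) ⟩
    1ℚ                                              ∎

-- Finite sums

Sum : ℕ → (ℕ → ℚ) → ℚ
Sum zero f = 0ℚ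
Sum (suc n) f = Sum n f + f n

Sum-cong : ∀ n {f g : ℕ → ℚ} → (∀ i → i < n → f i ≡ g i) → Sum n f ≡ Sum n g
Sum-cong zero eq = refl
Sum-cong (suc n) eq = cong₂ _+_ (Sum-cong n (λ i i<n → eq i (ℕP.m≤n⇒m≤1+n i<n))) (eq n ℕP.≤-refl)

Sum-cong-≗ : ∀ n {f g : ℕ → ℚ} → (∀ i → f i ≡ g i) → Sum n f ≡ Sum n g
Sum-cong-≗ n eq = Sum-cong n (λ i _ → eq i)

Sum-zeros : ∀ n (f : ℕ → ℚ) → (∀ i → i < n → f i ≡ 0ℚ) → Sum n f ≡ 0ℚ
Sum-zeros zero f eq = refl
Sum-zeros (suc n) f eq = trans (cong₂ _+_ (Sum-zeros n f (λ i i<n → eq i (ℕP.m≤n⇒m≤1+n i<n))) (eq n ℕP.≤-refl)) (+-identityʳ 0ℚ)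

Sum-distrib-+ : ∀ n (f g : ℕ → ℚ) → Sum n (λ i → f i + g i) ≡ Sum n f + Sum n g
Sum-distrib-+ zero f g = sym (+-identityˡ 0ℚ)
Sum-distrib-+ (suc n) f g = begin
  Sum n (λ i → f i + g i) + (f n + g n) ≡⟨ cong (_+ (f n + g n)) (Sum-distrib-+ n f g) ⟩
  Sum n f + Sum n g + (f n + g n)       ≡⟨ solve 4 (λ a b c d → a :+ b :+ (c :+ d) := a :+ c :+ (b :+ d)) refl (Sum n f) (Sum n g) (f n) (g n) ⟩
  Sum n f + f n + (Sum n g + g n)       ∎

*-distribˡ-Sum : ∀ n c (f : ℕ → ℚ) → c * Sum n f ≡ Sum n (λ i → c * f i)
*-distribˡ-Sum zero c f = *-zeroʳ c
*-distribˡ-Sum (suc n) c f = trans (*-distribˡ-+ c (Sum n f) (f n)) (cong (_+ c * f n) (*-distribˡ-Sum n c f))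

*-distribʳ-Sum : ∀ n c (f : ℕ → ℚ) → Sum n f * c ≡ Sum n (λ i → f i * c)
*-distribʳ-Sum n c f = trans (*-comm (Sum n f) c) (trans (*-distribˡ-Sum n c f) (Sum-cong-≗ n (λ i → *-comm c (f i))))

neg-distrib-Sum : ∀ n (f : ℕ → ℚ) → - Sum n f ≡ Sum n (λ i → - f i)
neg-distrib-Sum zero f = refl
neg-distrib-Sum (suc n) f = trans (neg-distrib-+ (Sum n f) (f n)) (cong (_+ - f n) (neg-distrib-Sum n f))

Sum-head : ∀ n (f : ℕ → ℚ) → Sum (suc n) f ≡ f 0 + Sum n (f ∘ suc)
Sum-head zero f = trans (+-identityˡ (f 0)) (sym (+-identityʳ (f 0)))
Sum-head (suc n) f = begin
  Sum (suc n) f + f (suc n)             ≡⟨ cong (_+ f (suc n)) (Sum-head n f) ⟩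
  f 0 + Sum n (f ∘ suc) + f (suc n)     ≡⟨ +-assoc (f 0) _ _ ⟩
  f 0 + (Sum n (f ∘ suc) + f (suc n))   ∎

Sum-head-0 : ∀ n (f : ℕ → ℚ) → f 0 ≡ 0ℚ → Sum (suc n) f ≡ Sum n (f ∘ suc)
Sum-head-0 n f f0≡0 = trans (Sum-head n f) (trans (cong (_+ Sum n (f ∘ suc)) f0≡0) (+-identityˡ _))

Sum-last-0 : ∀ n (f : ℕ → ℚ) → f n ≡ 0ℚ → Sum (suc n) f ≡ Sum n f
Sum-last-0 n f fn≡0 = trans (cong (Sum n f +_) fn≡0) (+-identityʳ _)

Sum-split : ∀ m n (f : ℕ → ℚ) → Sum (m ℕ.+ n) f ≡ Sum m f + Sum n (λ i → f (m ℕ.+ i))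
Sum-split m zero f = trans (cong (λ k → Sum k f) (ℕP.+-identityʳ m)) (sym (+-identityʳ _))
Sum-split m (suc n) f = begin
  Sum (m ℕ.+ suc n) f                                  ≡⟨ cong (λ k → Sum k f) (ℕP.+-suc m n) ⟩
  Sum (m ℕ.+ n) f + f (m ℕ.+ n)                        ≡⟨ cong (_+ f (m ℕ.+ n)) (Sum-split m n f) ⟩
  Sum m f + Sum n (λ i → f (m ℕ.+ i)) + f (m ℕ.+ n)    ≡⟨ +-assoc (Sum m f) _ _ ⟩
  Sum m f + (Sum n (λ i → f (m ℕ.+ i)) + f (m ℕ.+ n))  ∎

Sum-truncate : ∀ n k (f : ℕ → ℚ) → k ≤ n → (∀ i → k ≤ i → i < n → f i ≡ 0ℚ) → Sum n f ≡ Sum k f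
Sum-truncate n k f k≤n vanish = begin
  Sum n f                                    ≡⟨ cong (λ t → Sum t f) (ℕP.m+[n∸m]≡n k≤n) ⟨
  Sum (k ℕ.+ (n ∸ k)) f                      ≡⟨ Sum-split k (n ∸ k) f ⟩
  Sum k f + Sum (n ∸ k) (λ i → f (k ℕ.+ i))  ≡⟨ cong (Sum k f +_) (Sum-zeros (n ∸ k) _ tail≡0) ⟩
  Sum k f + 0ℚ                               ≡⟨ +-identityʳ _ ⟩
  Sum k f                                    ∎
  where
  tail≡0 : ∀ i → i < n ∸ k → f (k ℕ.+ i) ≡ 0ℚ
  tail≡0 i i<n∸k = vanish (k ℕ.+ i) (ℕP.m≤m+n k i)
    (subst (k ℕ.+ i <_) (ℕP.m+[n∸m]≡n k≤n) (ℕP.+-monoʳ-< k i<n∸k))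

Sum-comm : ∀ n m (f : ℕ → ℕ → ℚ) → Sum n (λ i → Sum m (λ j → f i j)) ≡ Sum m (λ j → Sum n (λ i → f i j))
Sum-comm zero m f = sym (Sum-zeros m _ (λ _ _ → refl))
Sum-comm (suc n) m f = begin
  Sum n (λ i → Sum m (λ j → f i j)) + Sum m (λ j → f n j) ≡⟨ cong (_+ Sum m (λ j → f n j)) (Sum-comm n m f) ⟩
  Sum m (λ j → Sum n (λ i → f i j)) + Sum m (λ j → f n j) ≡⟨ Sum-distrib-+ m _ _ ⟨
  Sum m (λ j → Sum n (λ i → f i j) + f n j)               ∎

Sum-reverse : ∀ n (f : ℕ → ℚ) → Sum n f ≡ Sum n (λ i → f (n ∸ suc i))
Sum-reverse zero f = refl
Sum-reverse (suc n) f = begin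
  Sum n f + f n                          ≡⟨ cong (_+ f n) (Sum-reverse n f) ⟩
  Sum n (λ i → f (n ∸ suc i)) + f n      ≡⟨ +-comm _ (f n) ⟩
  f n + Sum n (λ i → f (n ∸ suc i))      ≡⟨ Sum-head n (λ i → f (suc n ∸ suc i)) ⟨
  Sum (suc n) (λ i → f (suc n ∸ suc i))  ∎


Sum-triangle : ∀ n (T : ℕ → ℕ → ℚ) →
  Sum (suc n) (λ k → Sum (suc k) (λ i → T i k)) ≡ Sum (suc n) (λ i → Sum (suc (n ∸ i)) (λ j → T i (i ℕ.+ j)))
Sum-triangle zero T = refl
Sum-triangle (suc n) T = begin
  Sum (suc n) (λ k → Sum (suc k) (λ i → T i k)) + Sum (suc (suc n)) (λ i → T i (suc n))
    ≡⟨ cong (_+ Sum (suc (suc n)) (λ i → T i (suc n))) (Sum-triangle n T) ⟩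
  R + (Sum (suc n) (λ i → T i (suc n)) + T (suc n) (suc n))
    ≡⟨ +-assoc R _ _ ⟨
  R + Sum (suc n) (λ i → T i (suc n)) + T (suc n) (suc n)
    ≡⟨ cong (_+ T (suc n) (suc n)) (Sum-distrib-+ (suc n) _ _) ⟨
  Sum (suc n) (λ i → Sum (suc (n ∸ i)) (λ j → T i (i ℕ.+ j)) + T i (suc n)) + T (suc n) (suc n)
    ≡⟨ cong₂ _+_ (Sum-cong (suc n) extend-row) last-row ⟩
  Sum (suc n) (λ i → Sum (suc (suc n ∸ i)) (λ j → T i (i ℕ.+ j))) + Sum (suc (suc n ∸ suc n)) (λ j → T (suc n) (suc n ℕ.+ j)) ∎
  where
  R = Sum (suc n) (λ i → Sum (suc (n ∸ i)) (λ j → T i (i ℕ.+ j)))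
  extend-row : ∀ i → i < suc n → Sum (suc (n ∸ i)) (λ j → T i (i ℕ.+ j)) + T i (suc n) ≡ Sum (suc (suc n ∸ i)) (λ j → T i (i ℕ.+ j))
  extend-row i (s≤s i≤n) = begin
    Sum (suc (n ∸ i)) (λ j → T i (i ℕ.+ j)) + T i (suc n)
      ≡⟨ cong (λ t → Sum (suc (n ∸ i)) (λ j → T i (i ℕ.+ j)) + T i t) i+[1+n-i]≡1+n ⟨
    Sum (suc (suc (n ∸ i))) (λ j → T i (i ℕ.+ j))
      ≡⟨ cong (λ t → Sum (suc t) (λ j → T i (i ℕ.+ j))) (ℕP.+-∸-assoc 1 i≤n) ⟨
    Sum (suc (suc n ∸ i)) (λ j → T i (i ℕ.+ j)) ∎
    where
    i+[1+n-i]≡1+n : i ℕ.+ suc (n ∸ i) ≡ suc n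
    i+[1+n-i]≡1+n = trans (ℕP.+-suc i (n ∸ i)) (cong suc (ℕP.m+[n∸m]≡n i≤n))
  last-row : T (suc n) (suc n) ≡ Sum (suc (suc n ∸ suc n)) (λ j → T (suc n) (suc n ℕ.+ j))
  last-row = begin
    T (suc n) (suc n)                                     ≡⟨ +-identityˡ _ ⟨
    0ℚ + T (suc n) (suc n)                                ≡⟨ cong (λ t → 0ℚ + T (suc n) t) (ℕP.+-identityʳ (suc n)) ⟨
    Sum 1 (λ j → T (suc n) (suc n ℕ.+ j))                 ≡⟨ cong (λ t → Sum (suc t) (λ j → T (suc n) (suc n ℕ.+ j))) (ℕP.n∸n≡0 n) ⟨
    Sum (suc (suc n ∸ suc n)) (λ j → T (suc n) (suc n ℕ.+ j)) ∎

δ : ℕ → ℕ → ℚ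
δ m i with m ℕ.≟ i
... | yes _ = 1ℚ
... | no _ = 0ℚ

δ-refl : ∀ m → δ m m ≡ 1ℚ
δ-refl m with m ℕ.≟ m
... | yes _ = refl
... | no m≢m = ⊥-elim (m≢m refl)

δ-≢ : ∀ m i → m ≢ i → δ m i ≡ 0ℚ
δ-≢ m i m≢i with m ℕ.≟ i
... | yes m≡i = ⊥-elim (m≢i m≡i)
... | no _ = refl

δ-> : ∀ m i → i < m → δ m i ≡ 0ℚ
δ-> m i i<m = δ-≢ m i (λ m≡i → ℕP.<⇒≢ i<m (sym m≡i))

δ-sym : ∀ m i → δ m i ≡ δ i m
δ-sym m i with m ℕ.≟ i | i ℕ.≟ m
... | yes _ | yes _ = refl
... | no _ | no _ = refl
... | yes m≡i | no i≢m = ⊥-elim (i≢m (sym m≡i))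
... | no m≢i | yes i≡m = ⊥-elim (m≢i (sym i≡m))

δ-∸ : ∀ a b n → a ≤ n → δ b (n ∸ a) ≡ δ (a ℕ.+ b) n
δ-∸ a b n a≤n with b ℕ.≟ (n ∸ a)
... | yes b≡n∸a = sym (trans (cong (λ z → δ (a ℕ.+ z) n) b≡n∸a) (trans (cong (λ z → δ z n) (ℕP.m+[n∸m]≡n a≤n)) (δ-refl n)))
... | no b≢n∸a = sym (δ-≢ (a ℕ.+ b) n (λ a+b≡n → b≢n∸a (trans (sym (ℕP.m+n∸m≡n a b)) (cong (_∸ a) a+b≡n))))

Sum-δ : ∀ n m (f : ℕ → ℚ) → m < n → Sum n (λ i → δ m i * f i) ≡ f m
Sum-δ (suc n) m f (s≤s m≤n) with ℕP.m≤n⇒m<n∨m≡n m≤n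
... | inj₁ m<n = begin
  Sum n (λ i → δ m i * f i) + δ m n * f n ≡⟨ cong₂ _+_ (Sum-δ n m f m<n) (cong (_* f n) (δ-≢ m n (ℕP.<⇒≢ m<n))) ⟩
  f m + 0ℚ * f n                          ≡⟨ solve 2 (λ a b → a :+ con 0ℚ :* b := a) refl (f m) (f n) ⟩
  f m                                     ∎
... | inj₂ refl = begin
  Sum m (λ i → δ m i * f i) + δ m m * f m ≡⟨ cong₂ _+_ (Sum-zeros m _ below) (cong (_* f m) (δ-refl m)) ⟩
  0ℚ + 1ℚ * f m                           ≡⟨ solve 1 (λ a → con 0ℚ :+ con 1ℚ :* a := a) refl (f m) ⟩
  f m                                     ∎
  where
  below : ∀ i → i < m → δ m i * f i ≡ 0ℚ
  below i i<m = trans (cong (_* f i) (δ-> m i i<m)) (*-zeroˡ (f i))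

Sum-δ-≥ : ∀ n m (f : ℕ → ℚ) → n ≤ m → Sum n (λ i → δ m i * f i) ≡ 0ℚ
Sum-δ-≥ n m f n≤m = Sum-zeros n _ (λ i i<n → trans (cong (_* f i) (δ-> m i (ℕP.<-≤-trans i<n n≤m))) (*-zeroˡ (f i)))

sumℚ-map-upTo : ∀ n (f : ℕ → ℚ) → sumℚ (map f (upTo n)) ≡ Sum n f
sumℚ-map-upTo n f = go n (λ i → i)
  where
  go : ∀ n (t : ℕ → ℕ) → sumℚ (map f (applyUpTo t n)) ≡ Sum n (f ∘ t)
  go zero t = refl
  go (suc n) t = trans (cong (f (t 0) +_) (go n (t ∘ suc))) (sym (Sum-head n (f ∘ t)))

fromℕ-sumℕ-range1 : ∀ n (f : ℕ → ℕ) → fromℕ (sumℕ (map f (range1 n))) ≡ Sum n (λ i → fromℕ (f (suc i)))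
fromℕ-sumℕ-range1 n f = go n (λ i → i)
  where
  go : ∀ n (t : ℕ → ℕ) → fromℕ (sumℕ (map f (map suc (applyUpTo t n)))) ≡ Sum n (λ i → fromℕ (f (suc (t i))))
  go zero t = refl
  go (suc n) t = begin
    fromℕ (f (suc (t 0)) ℕ.+ rest)                              ≡⟨ fromℕ-+ (f (suc (t 0))) rest ⟩
    fromℕ (f (suc (t 0))) + fromℕ rest                          ≡⟨ cong (fromℕ (f (suc (t 0))) +_) (go n (t ∘ suc)) ⟩
    fromℕ (f (suc (t 0))) + Sum n (λ i → fromℕ (f (suc (t (suc i))))) ≡⟨ Sum-head n _ ⟨
    Sum (suc n) (λ i → fromℕ (f (suc (t i))))                    ∎
    where rest = sumℕ (map f (map suc (applyUpTo (t ∘ suc) n)))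

-- Formal power series

·-as-Sum : ∀ (f g : Series) n → (f · g) n ≡ Sum (suc n) (λ k → f k * g (n ∸ k))
·-as-Sum f g n = sumℚ-map-upTo (suc n) (λ k → f k * g (n ∸ k))

·-congˡ : ∀ {f f′ : Series} (g : Series) n → (∀ k → k ≤ n → f k ≡ f′ k) → (f · g) n ≡ (f′ · g) n
·-congˡ {f} {f′} g n eq = begin
  (f · g) n                             ≡⟨ ·-as-Sum f g n ⟩
  Sum (suc n) (λ k → f k * g (n ∸ k))   ≡⟨ Sum-cong (suc n) (λ k k≤n → cong (_* g (n ∸ k)) (eq k (ℕP.≤-pred k≤n))) ⟩
  Sum (suc n) (λ k → f′ k * g (n ∸ k))  ≡⟨ ·-as-Sum f′ g n ⟨
  (f′ · g) n                            ∎

·-comm : ∀ (f g : Series) → f · g ≗ g · f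
·-comm f g n = begin
  (f · g) n                                          ≡⟨ ·-as-Sum f g n ⟩
  Sum (suc n) (λ k → f k * g (n ∸ k))                ≡⟨ Sum-reverse (suc n) _ ⟩
  Sum (suc n) (λ i → f (n ∸ i) * g (n ∸ (n ∸ i)))    ≡⟨ Sum-cong (suc n) swap ⟩
  Sum (suc n) (λ k → g k * f (n ∸ k))                ≡⟨ ·-as-Sum g f n ⟨
  (g · f) n                                          ∎
  where
  swap : ∀ i → i < suc n → f (n ∸ i) * g (n ∸ (n ∸ i)) ≡ g i * f (n ∸ i)
  swap i (s≤s i≤n) = trans (*-comm (f (n ∸ i)) _) (cong (λ t → g t * f (n ∸ i)) (ℕP.m∸[m∸n]≡n i≤n))

·-congʳ : ∀ (f : Series) {g g′ : Series} n → (∀ k → k ≤ n → g k ≡ g′ k) → (f · g) n ≡ (f · g′) n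
·-congʳ f {g} {g′} n eq = trans (·-comm f g n) (trans (·-congˡ f n eq) (·-comm g′ f n))

·-assoc : ∀ (f g h : Series) → (f · g) · h ≗ f · (g · h)
·-assoc f g h n = begin
  ((f · g) · h) n
    ≡⟨ ·-as-Sum (f · g) h n ⟩
  Sum (suc n) (λ k → (f · g) k * h (n ∸ k))
    ≡⟨ Sum-cong-≗ (suc n) (λ k → trans (cong (_* h (n ∸ k)) (·-as-Sum f g k)) (*-distribʳ-Sum (suc k) _ _)) ⟩
  Sum (suc n) (λ k → Sum (suc k) (λ i → f i * g (k ∸ i) * h (n ∸ k)))
    ≡⟨ Sum-triangle n (λ i k → f i * g (k ∸ i) * h (n ∸ k)) ⟩
  Sum (suc n) (λ i → Sum (suc (n ∸ i)) (λ j → f i * g (i ℕ.+ j ∸ i) * h (n ∸ (i ℕ.+ j))))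
    ≡⟨ Sum-cong-≗ (suc n) (λ i → Sum-cong-≗ (suc (n ∸ i)) (λ j → reindex i j)) ⟩
  Sum (suc n) (λ i → Sum (suc (n ∸ i)) (λ j → f i * (g j * h (n ∸ i ∸ j))))
    ≡⟨ Sum-cong-≗ (suc n) (λ i → trans (cong (f i *_) (·-as-Sum g h (n ∸ i))) (*-distribˡ-Sum (suc (n ∸ i)) (f i) _)) ⟨
  Sum (suc n) (λ k → f k * (g · h) (n ∸ k))
    ≡⟨ ·-as-Sum f (g · h) n ⟨
  (f · (g · h)) n ∎
  where
  reindex : ∀ i j → f i * g (i ℕ.+ j ∸ i) * h (n ∸ (i ℕ.+ j)) ≡ f i * (g j * h (n ∸ i ∸ j))
  reindex i j = trans (cong₂ (λ a b → f i * g a * h b) (ℕP.m+n∸m≡n i j) (sym (ℕP.∸-+-assoc n i j))) (*-assoc (f i) _ _)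

·-distribʳ-+ : ∀ (f g h : Series) → (λ k → f k + g k) · h ≗ λ n → (f · h) n + (g · h) n
·-distribʳ-+ f g h n = begin
  ((λ k → f k + g k) · h) n                                                    ≡⟨ ·-as-Sum (λ k → f k + g k) h n ⟩
  Sum (suc n) (λ k → (f k + g k) * h (n ∸ k))                                  ≡⟨ Sum-cong-≗ (suc n) (λ k → *-distribʳ-+ (h (n ∸ k)) (f k) (g k)) ⟩
  Sum (suc n) (λ k → f k * h (n ∸ k) + g k * h (n ∸ k))                        ≡⟨ Sum-distrib-+ (suc n) _ _ ⟩
  Sum (suc n) (λ k → f k * h (n ∸ k)) + Sum (suc n) (λ k → g k * h (n ∸ k))    ≡⟨ cong₂ _+_ (·-as-Sum f h n) (·-as-Sum g h n) ⟨
  (f · h) n + (g · h) n                                                        ∎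

·-distribˡ-+ : ∀ (f g h : Series) → f · (λ k → g k + h k) ≗ λ n → (f · g) n + (f · h) n
·-distribˡ-+ f g h n = trans (·-comm f (λ k → g k + h k) n) (trans (·-distribʳ-+ g h f n) (cong₂ _+_ (·-comm g f n) (·-comm h f n)))

*-·ˡ : ∀ c (f h : Series) → (λ k → c * f k) · h ≗ λ n → c * (f · h) n
*-·ˡ c f h n = begin
  ((λ k → c * f k) · h) n                    ≡⟨ ·-as-Sum (λ k → c * f k) h n ⟩
  Sum (suc n) (λ k → c * f k * h (n ∸ k))    ≡⟨ Sum-cong-≗ (suc n) (λ k → *-assoc c (f k) _) ⟩
  Sum (suc n) (λ k → c * (f k * h (n ∸ k)))  ≡⟨ *-distribˡ-Sum (suc n) c _ ⟨
  c * Sum (suc n) (λ k → f k * h (n ∸ k))    ≡⟨ cong (c *_) (·-as-Sum f h n) ⟨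
  c * (f · h) n                              ∎

*-·ʳ : ∀ c (f h : Series) → f · (λ k → c * h k) ≗ λ n → c * (f · h) n
*-·ʳ c f h n = trans (·-comm f (λ k → c * h k) n) (trans (*-·ˡ c h f n) (cong (c *_) (·-comm h f n)))

·-zeroˡ : ∀ (f h : Series) → (∀ k → f k ≡ 0ℚ) → ∀ n → (f · h) n ≡ 0ℚ
·-zeroˡ f h f≡0 n = trans (·-as-Sum f h n) (Sum-zeros (suc n) _ (λ k _ → trans (cong (_* h (n ∸ k)) (f≡0 k)) (*-zeroˡ (h (n ∸ k)))))

𝟙 : Series
𝟙 = bracket []

𝟙-≢0 : ∀ {m} → m ≢ 0 → 𝟙 m ≡ 0ℚ
𝟙-≢0 {zero} 0≢0 = ⊥-elim (0≢0 refl)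
𝟙-≢0 {suc m} _ = refl

·-identityˡ : ∀ (h : Series) → 𝟙 · h ≗ h
·-identityˡ h n = begin
  (𝟙 · h) n                                        ≡⟨ ·-as-Sum 𝟙 h n ⟩
  Sum (suc n) (λ k → 𝟙 k * h (n ∸ k))              ≡⟨ Sum-head n _ ⟩
  1ℚ * h n + Sum n (λ k → 0ℚ * h (n ∸ suc k))      ≡⟨ cong₂ _+_ (*-identityˡ (h n)) (Sum-zeros n _ (λ k _ → *-zeroˡ (h (n ∸ suc k)))) ⟩
  h n + 0ℚ                                         ≡⟨ +-identityʳ (h n) ⟩
  h n                                              ∎

·-identityʳ : ∀ (h : Series) → h · 𝟙 ≗ h
·-identityʳ h n = trans (·-comm h 𝟙 n) (·-identityˡ h n)

·-exchange : ∀ (f g h : Series) → f · (g · h) ≗ g · (f · h)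
·-exchange f g h n = begin
  (f · (g · h)) n ≡⟨ ·-assoc f g h n ⟨
  ((f · g) · h) n ≡⟨ ·-congˡ h n (λ k _ → ·-comm f g k) ⟩
  ((g · f) · h) n ≡⟨ ·-assoc g f h n ⟩
  (g · (f · h)) n ∎

-- The exponential series

pow : ℚ → ℕ → ℚ
pow x zero = 1ℚ
pow x (suc k) = x * pow x k

fromℕ-^ : ∀ m k → fromℕ (m ^ k) ≡ pow (fromℕ m) k
fromℕ-^ m zero = +-identityʳ 1ℚ
fromℕ-^ m (suc k) = trans (fromℕ-* m (m ^ k)) (cong (fromℕ m *_) (fromℕ-^ m k))

expCoeff : ℚ → Series
expCoeff x i = pow x i * invFact i

deriv : Series → Series
deriv f k = fromℕ (suc k) * f (suc k)

deriv-expCoeff : ∀ x → deriv (expCoeff x) ≗ λ i → x * expCoeff x i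
deriv-expCoeff x i = begin
  fromℕ (suc i) * (x * pow x i * invFact (suc i))   ≡⟨ solve 4 (λ a b c d → a :* (b :* c :* d) := b :* c :* (d :* a)) refl (fromℕ (suc i)) x (pow x i) (invFact (suc i)) ⟩
  x * pow x i * (invFact (suc i) * fromℕ (suc i))   ≡⟨ cong (x * pow x i *_) (invFact-suc i) ⟩
  x * pow x i * invFact i                           ≡⟨ *-assoc x _ _ ⟩
  x * expCoeff x i                                  ∎

deriv-· : ∀ (f g : Series) → deriv (f · g) ≗ λ n → (deriv f · g) n + (f · deriv g) n
deriv-· f g n = begin
  fromℕ (suc n) * (f · g) (suc n)
    ≡⟨ cong (fromℕ (suc n) *_) (·-as-Sum f g (suc n)) ⟩
  fromℕ (suc n) * Sum (suc (suc n)) (λ k → f k * g (suc n ∸ k))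
    ≡⟨ *-distribˡ-Sum (suc (suc n)) (fromℕ (suc n)) _ ⟩
  Sum (suc (suc n)) (λ k → fromℕ (suc n) * (f k * g (suc n ∸ k)))
    ≡⟨ Sum-cong (suc (suc n)) split ⟩
  Sum (suc (suc n)) (λ k → fromℕ k * f k * g (suc n ∸ k) + f k * (fromℕ (suc n ∸ k) * g (suc n ∸ k)))
    ≡⟨ Sum-distrib-+ (suc (suc n)) _ _ ⟩
  Sum (suc (suc n)) (λ k → fromℕ k * f k * g (suc n ∸ k)) + Sum (suc (suc n)) (λ k → f k * (fromℕ (suc n ∸ k) * g (suc n ∸ k)))
    ≡⟨ cong₂ _+_ left right ⟩
  (deriv f · g) n + (f · deriv g) n ∎
  where
  split : ∀ k → k < suc (suc n) → fromℕ (suc n) * (f k * g (suc n ∸ k)) ≡ fromℕ k * f k * g (suc n ∸ k) + f k * (fromℕ (suc n ∸ k) * g (suc n ∸ k))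
  split k (s≤s k≤1+n) = begin
    fromℕ (suc n) * (f k * g (suc n ∸ k))                   ≡⟨ cong (λ t → fromℕ t * (f k * g (suc n ∸ k))) (ℕP.m+[n∸m]≡n k≤1+n) ⟨
    fromℕ (k ℕ.+ (suc n ∸ k)) * (f k * g (suc n ∸ k))       ≡⟨ cong (_* (f k * g (suc n ∸ k))) (fromℕ-+ k (suc n ∸ k)) ⟩
    (fromℕ k + fromℕ (suc n ∸ k)) * (f k * g (suc n ∸ k))   ≡⟨ solve 4 (λ a b c d → (a :+ b) :* (c :* d) := a :* c :* d :+ c :* (b :* d)) refl (fromℕ k) (fromℕ (suc n ∸ k)) (f k) (g (suc n ∸ k)) ⟩
    fromℕ k * f k * g (suc n ∸ k) + f k * (fromℕ (suc n ∸ k) * g (suc n ∸ k)) ∎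
  left : Sum (suc (suc n)) (λ k → fromℕ k * f k * g (suc n ∸ k)) ≡ (deriv f · g) n
  left = trans (Sum-head-0 (suc n) _ (solve 2 (λ a b → con 0ℚ :* a :* b := con 0ℚ) refl (f 0) (g (suc n)))) (sym (·-as-Sum (deriv f) g n))
  right : Sum (suc (suc n)) (λ k → f k * (fromℕ (suc n ∸ k) * g (suc n ∸ k))) ≡ (f · deriv g) n
  right = begin
    Sum (suc (suc n)) (λ k → f k * (fromℕ (suc n ∸ k) * g (suc n ∸ k)))
      ≡⟨ Sum-last-0 (suc n) _ (trans (cong (λ t → f (suc n) * (fromℕ t * g t)) (ℕP.n∸n≡0 n)) (solve 2 (λ a b → a :* (con 0ℚ :* b) := con 0ℚ) refl (f (suc n)) (g 0))) ⟩
    Sum (suc n) (λ k → f k * (fromℕ (suc n ∸ k) * g (suc n ∸ k)))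
      ≡⟨ Sum-cong (suc n) (λ k k<1+n → cong (λ t → f k * (fromℕ t * g t)) (ℕP.+-∸-assoc 1 (ℕP.≤-pred k<1+n))) ⟩
    Sum (suc n) (λ k → f k * deriv g (n ∸ k))
      ≡⟨ ·-as-Sum f (deriv g) n ⟨
    (f · deriv g) n ∎

expCoeff-+ : ∀ x y → expCoeff (x + y) ≗ expCoeff x · expCoeff y
expCoeff-+ x y zero = refl
expCoeff-+ x y (suc i) = *-cancelˡ-fromℕ-suc i (begin
  deriv (expCoeff (x + y)) i                                   ≡⟨ deriv-expCoeff (x + y) i ⟩
  (x + y) * expCoeff (x + y) i                                 ≡⟨ cong ((x + y) *_) (expCoeff-+ x y i) ⟩
  (x + y) * (ex · ey) i                                        ≡⟨ *-distribʳ-+ ((ex · ey) i) x y ⟩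
  x * (ex · ey) i + y * (ex · ey) i                            ≡⟨ cong₂ _+_ (*-·ˡ x ex ey i) (*-·ʳ y ex ey i) ⟨
  ((λ k → x * ex k) · ey) i + (ex · (λ k → y * ey k)) i        ≡⟨ cong₂ _+_ (·-congˡ ey i (λ k _ → deriv-expCoeff x k)) (·-congʳ ex i (λ k _ → deriv-expCoeff y k)) ⟨
  (deriv ex · ey) i + (ex · deriv ey) i                        ≡⟨ deriv-· ex ey i ⟨
  deriv (ex · ey) i                                            ∎)
  where
  ex = expCoeff x
  ey = expCoeff y

-- Bernoulli numbers

fromℕ-C : ∀ {n k} → k ≤ n → fromℕ (n C k) ≡ fromℕ (n !) * invFact k * invFact (n ∸ k)
fromℕ-C {n} {k} k≤n = begin
  fromℕ (n C k)
    ≡⟨ solve 1 (λ c → c :* con 1ℚ :* con 1ℚ := c) refl (fromℕ (n C k)) ⟨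
  fromℕ (n C k) * 1ℚ * 1ℚ
    ≡⟨ cong₂ (λ a b → fromℕ (n C k) * a * b) (fromℕ!*invFact k) (fromℕ!*invFact (n ∸ k)) ⟨
  fromℕ (n C k) * (fromℕ (k !) * invFact k) * (fromℕ ((n ∸ k) !) * invFact (n ∸ k))
    ≡⟨ solve 5 (λ c a a⁻¹ b b⁻¹ → c :* (a :* a⁻¹) :* (b :* b⁻¹) := c :* (a :* b) :* a⁻¹ :* b⁻¹) refl (fromℕ (n C k)) (fromℕ (k !)) (invFact k) (fromℕ ((n ∸ k) !)) (invFact (n ∸ k)) ⟩
  fromℕ (n C k) * (fromℕ (k !) * fromℕ ((n ∸ k) !)) * invFact k * invFact (n ∸ k)
    ≡⟨ cong (λ t → t * invFact k * invFact (n ∸ k)) (trans (fromℕ-* (n C k) _) (cong (fromℕ (n C k) *_) (fromℕ-* (k !) ((n ∸ k) !)))) ⟨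
  fromℕ ((n C k) ℕ.* (k ! ℕ.* (n ∸ k) !)) * invFact k * invFact (n ∸ k)
    ≡⟨ cong (λ t → fromℕ t * invFact k * invFact (n ∸ k)) C*k!*[n∸k]!≡n! ⟩
  fromℕ (n !) * invFact k * invFact (n ∸ k) ∎
  where
  C*k!*[n∸k]!≡n! : (n C k) ℕ.* (k ! ℕ.* (n ∸ k) !) ≡ n !
  C*k!*[n∸k]!≡n! = trans (cong (ℕ._* (k ! ℕ.* (n ∸ k) !)) (nCk≡n!/k![n-k]! k≤n)) (m/n*n≡m {{k !* (n ∸ k) !≢0}} (k![n∸k]!∣n! k≤n))

bernRev-sum : ∀ n (F : ℕ × ℚ → ℚ) → sumℚ (map F (zip (downFrom (suc n)) (bernRev n))) ≡ Sum (suc n) (λ k → F (k , bernoulli k))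
bernRev-sum zero F = trans (+-identityʳ (F (0 , 1ℚ))) (sym (+-identityˡ (F (0 , 1ℚ))))
bernRev-sum (suc n) F = trans (cong (F (suc n , bernoulli (suc n)) +_) (bernRev-sum n F)) (+-comm (F (suc n , bernoulli (suc n))) _)

bernoulli-recurrence : ∀ n → fromℕ (suc (suc n)) * bernoulli (suc n) ≡ - Sum (suc n) (λ k → fromℕ (suc (suc n) C k) * bernoulli k)
bernoulli-recurrence n = begin
  fromℕ N * (- 1/N * S)       ≡⟨ solve 3 (λ a b c → a :* (:- b :* c) := :- (b :* a) :* c) refl (fromℕ N) 1/N S ⟩
  - (1/N * fromℕ N) * S       ≡⟨ cong (λ t → - t * S) ([k/n]*n≡k 1 N) ⟩
  - 1ℚ * S                    ≡⟨ solve 1 (λ a → :- con 1ℚ :* a := :- a) refl S ⟩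
  - S                         ≡⟨ cong -_ (trans (bernRev-sum n _) (Sum-cong-≗ (suc n) (λ k → cong (_* bernoulli k) (k/1≡fromℕ (N C k))))) ⟩
  - Sum (suc n) (λ k → fromℕ (N C k) * bernoulli k) ∎
  where
  N = suc (suc n)
  1/N = ℤ.+ 1 / N
  S = sumℚ (map (λ { (k , b) → ((ℤ.+ (N C k)) / 1) * b }) (zip (downFrom (suc n)) (bernRev n)))

-- B_t/t!, the coefficients of x/(eˣ − 1)
β : ℕ → ℚ
β t = bernoulli t * invFact t

Sum-β-invFact : ∀ n → Sum (suc n) (λ t → β t * invFact (suc n ∸ t)) ≡ 𝟙 n
Sum-β-invFact zero = refl
Sum-β-invFact (suc n) = begin
  Sum N f                              ≡⟨ *-identityˡ _ ⟨
  1ℚ * Sum N f                         ≡⟨ cong (_* Sum N f) (invFact*fromℕ! N) ⟨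
  invFact N * fromℕ (N !) * Sum N f    ≡⟨ *-assoc (invFact N) _ _ ⟩
  invFact N * (fromℕ (N !) * Sum N f)  ≡⟨ cong (invFact N *_) N!*Sum≡0 ⟩
  invFact N * 0ℚ                       ≡⟨ *-zeroʳ (invFact N) ⟩
  0ℚ                                   ∎
  where
  N = suc (suc n)
  f = λ t → β t * invFact (N ∸ t)
  S = Sum (suc n) (λ k → fromℕ (N C k) * bernoulli k)
  N!*f : ∀ t → t < N → fromℕ (N !) * f t ≡ fromℕ (N C t) * bernoulli t
  N!*f t t<N = trans
    (solve 4 (λ a b c d → a :* (b :* c :* d) := a :* c :* d :* b) refl (fromℕ (N !)) (bernoulli t) (invFact t) (invFact (N ∸ t)))
    (cong (_* bernoulli t) (sym (fromℕ-C (ℕP.<⇒≤ t<N))))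
  NC1+n≡N : N C suc n ≡ N
  NC1+n≡N = trans (nCk≡nC[n∸k] (ℕP.n≤1+n (suc n))) (trans (cong (N C_) (trans (ℕP.+-∸-assoc 1 (ℕP.≤-refl {n})) (cong suc (ℕP.n∸n≡0 n)))) (nC1≡n N))
  N!*Sum≡0 : fromℕ (N !) * Sum N f ≡ 0ℚ
  N!*Sum≡0 = begin
    fromℕ (N !) * Sum N f                                    ≡⟨ *-distribˡ-Sum N (fromℕ (N !)) f ⟩
    Sum N (λ t → fromℕ (N !) * f t)                          ≡⟨ Sum-cong N N!*f ⟩
    S + fromℕ (N C suc n) * bernoulli (suc n)                ≡⟨ cong (λ t → S + fromℕ t * bernoulli (suc n)) NC1+n≡N ⟩
    S + fromℕ N * bernoulli (suc n)                          ≡⟨ cong (S +_) (bernoulli-recurrence n) ⟩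
    S + - S                                                  ≡⟨ +-inverseʳ S ⟩
    0ℚ                                                       ∎

signℚ-+ : ∀ a b → signℚ (a ℕ.+ b) ≡ signℚ a * signℚ b
signℚ-+ zero b = sym (*-identityˡ (signℚ b))
signℚ-+ (suc a) b = trans (cong -_ (signℚ-+ a b)) (neg-distribˡ-* (signℚ a) (signℚ b))

signℚ-square : ∀ a → signℚ a * signℚ a ≡ 1ℚ
signℚ-square zero = refl
signℚ-square (suc a) = trans (solve 1 (λ x → (:- x) :* (:- x) := x :* x) refl (signℚ a)) (signℚ-square a)

pow-[-1] : ∀ s → pow (- 1ℚ) s ≡ signℚ s
pow-[-1] zero = refl
pow-[-1] (suc s) = trans (cong ((- 1ℚ) *_) (pow-[-1] s)) (solve 1 (λ x → (:- con 1ℚ) :* x := :- x) refl (signℚ s))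

pow-1 : ∀ k → pow 1ℚ k ≡ 1ℚ
pow-1 zero = refl
pow-1 (suc k) = trans (*-identityˡ _) (pow-1 k)

expCoeff-1 : ∀ m → expCoeff 1ℚ m ≡ invFact m
expCoeff-1 m = trans (cong (_* invFact m) (pow-1 m)) (*-identityˡ _)

Sum-alternating-invFact : ∀ M → Sum (suc M) (λ s → signℚ s * invFact s * invFact (suc M ∸ s)) ≡ - (signℚ (suc M) * invFact (suc M))
Sum-alternating-invFact M = begin
  Sum (suc M) f                                            ≡⟨ solve 2 (λ a b → a := (a :+ b) :- b) refl (Sum (suc M) f) (f (suc M)) ⟩
  Sum (suc (suc M)) f - f (suc M)                          ≡⟨ cong (_- f (suc M)) full≡0 ⟩
  0ℚ - f (suc M)                                           ≡⟨ cong (λ t → 0ℚ - signℚ (suc M) * invFact (suc M) * invFact t) (ℕP.n∸n≡0 M) ⟩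
  0ℚ - signℚ (suc M) * invFact (suc M) * 1ℚ                ≡⟨ solve 2 (λ a b → con 0ℚ :- a :* b :* con 1ℚ := :- (a :* b)) refl (signℚ (suc M)) (invFact (suc M)) ⟩
  - (signℚ (suc M) * invFact (suc M))                      ∎
  where
  f = λ s → signℚ s * invFact s * invFact (suc M ∸ s)
  full≡0 : Sum (suc (suc M)) f ≡ 0ℚ
  full≡0 = begin
    Sum (suc (suc M)) f
      ≡⟨ Sum-cong-≗ (suc (suc M)) (λ s → cong₂ (λ a b → a * invFact s * b) (pow-[-1] s) (expCoeff-1 (suc M ∸ s))) ⟨
    Sum (suc (suc M)) (λ s → expCoeff (- 1ℚ) s * expCoeff 1ℚ (suc M ∸ s))   ≡⟨ ·-as-Sum (expCoeff (- 1ℚ)) (expCoeff 1ℚ) (suc M) ⟨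
    (expCoeff (- 1ℚ) · expCoeff 1ℚ) (suc M)                                  ≡⟨ expCoeff-+ (- 1ℚ) 1ℚ (suc M) ⟨
    expCoeff 0ℚ (suc M)                                                      ≡⟨ solve 2 (λ a b → con 0ℚ :* a :* b := con 0ℚ) refl (pow 0ℚ M) (invFact (suc M)) ⟩
    0ℚ                                                                       ∎

-- coefficients of eˣ x/(eˣ − 1), which by βExp-reflection is (−x)/(e⁻ˣ − 1)
βExp : ℕ → ℚ
βExp k = Sum (suc k) (λ t → β t * invFact (k ∸ t))

signed-βExp-recurrence : ∀ n → Sum (suc n) (λ k → signℚ k * βExp k * invFact (suc n ∸ k)) ≡ 𝟙 n
signed-βExp-recurrence n = begin
  Sum (suc n) (λ k → signℚ k * βExp k * invFact (suc n ∸ k))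
    ≡⟨ Sum-cong-≗ (suc n) (λ k → trans (cong (_* invFact (suc n ∸ k)) (*-distribˡ-Sum (suc k) (signℚ k) _)) (*-distribʳ-Sum (suc k) (invFact (suc n ∸ k)) _)) ⟩
  Sum (suc n) (λ k → Sum (suc k) (λ t → T t k))                     ≡⟨ Sum-triangle n T ⟩
  Sum (suc n) (λ t → Sum (suc (n ∸ t)) (λ s → T t (t ℕ.+ s)))       ≡⟨ Sum-cong (suc n) row ⟩
  Sum (suc n) (λ t → - signℚ (suc n) * (β t * invFact (suc n ∸ t))) ≡⟨ *-distribˡ-Sum (suc n) (- signℚ (suc n)) _ ⟨
  - signℚ (suc n) * Sum (suc n) (λ t → β t * invFact (suc n ∸ t))   ≡⟨ cong (- signℚ (suc n) *_) (Sum-β-invFact n) ⟩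
  - signℚ (suc n) * 𝟙 n                                             ≡⟨ sign𝟙 n ⟩
  𝟙 n                                                               ∎
  where
  T : ℕ → ℕ → ℚ
  T t k = signℚ k * (β t * invFact (k ∸ t)) * invFact (suc n ∸ k)
  sign𝟙 : ∀ n → - signℚ (suc n) * 𝟙 n ≡ 𝟙 n
  sign𝟙 zero = refl
  sign𝟙 (suc n) = *-zeroʳ (- signℚ (suc (suc n)))
  row : ∀ t → t < suc n → Sum (suc (n ∸ t)) (λ s → T t (t ℕ.+ s)) ≡ - signℚ (suc n) * (β t * invFact (suc n ∸ t))
  row t (s≤s t≤n) = begin
    Sum M (λ s → T t (t ℕ.+ s))
      ≡⟨ Sum-cong-≗ M (λ s → trans (term s) (solve 5 (λ a b c d f → a :* b :* (c :* d) :* f := c :* a :* (b :* d :* f)) refl (signℚ t) (signℚ s) (β t) (invFact s) (invFact (M ∸ s)))) ⟩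
    Sum M (λ s → β t * signℚ t * (signℚ s * invFact s * invFact (M ∸ s)))   ≡⟨ *-distribˡ-Sum M (β t * signℚ t) _ ⟨
    β t * signℚ t * Sum M (λ s → signℚ s * invFact s * invFact (M ∸ s))     ≡⟨ cong (β t * signℚ t *_) (Sum-alternating-invFact (n ∸ t)) ⟩
    β t * signℚ t * - (signℚ M * invFact M)                                 ≡⟨ solve 4 (λ a b c d → a :* b :* :- (c :* d) := :- (b :* c) :* (a :* d)) refl (β t) (signℚ t) (signℚ M) (invFact M) ⟩
    - (signℚ t * signℚ M) * (β t * invFact M)                               ≡⟨ cong₂ (λ a b → - a * (β t * invFact b)) (trans (sym (signℚ-+ t M)) (cong signℚ t+M≡1+n)) (sym 1+n∸t≡M) ⟩
    - signℚ (suc n) * (β t * invFact (suc n ∸ t))                           ∎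
    where
    M = suc (n ∸ t)
    1+n∸t≡M : suc n ∸ t ≡ M
    1+n∸t≡M = ℕP.+-∸-assoc 1 t≤n
    t+M≡1+n : t ℕ.+ M ≡ suc n
    t+M≡1+n = trans (ℕP.+-suc t (n ∸ t)) (cong suc (ℕP.m+[n∸m]≡n t≤n))
    term : ∀ s → T t (t ℕ.+ s) ≡ signℚ t * signℚ s * (β t * invFact s) * invFact (M ∸ s)
    term s = trans (cong₂ (λ a b → a * (β t * invFact b) * invFact (suc n ∸ (t ℕ.+ s))) (signℚ-+ t s) (ℕP.m+n∸m≡n t s))
      (cong (λ z → signℚ t * signℚ s * (β t * invFact s) * invFact z) (trans (sym (ℕP.∸-+-assoc (suc n) t s)) (cong (_∸ s) 1+n∸t≡M)))

Sum-invFact-injective : ∀ (x y : ℕ → ℚ) →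
  (∀ n → Sum (suc n) (λ k → x k * invFact (suc n ∸ k)) ≡ Sum (suc n) (λ k → y k * invFact (suc n ∸ k))) → ∀ n → x n ≡ y n
Sum-invFact-injective x y eq n = below (suc n) n ℕP.≤-refl
  where
  top : ∀ n (z : ℕ → ℚ) → z n * invFact (suc n ∸ n) ≡ z n
  top n z = trans (cong (λ t → z n * invFact t) (trans (ℕP.+-∸-assoc 1 (ℕP.≤-refl {n})) (cong suc (ℕP.n∸n≡0 n)))) (*-identityʳ (z n))
  below : ∀ m k → k < m → x k ≡ y k
  below (suc m) k (s≤s k≤m) with ℕP.m≤n⇒m<n∨m≡n k≤m
  ... | inj₁ k<m = below m k k<m
  ... | inj₂ refl = begin
    x k                           ≡⟨ top k x ⟨
    x k * invFact (suc k ∸ k)     ≡⟨ +-cancelˡ (Sum k (λ j → y j * invFact (suc k ∸ j))) _ _ (trans (cong (_+ x k * invFact (suc k ∸ k)) lower) (eq k)) ⟩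
    y k * invFact (suc k ∸ k)     ≡⟨ top k y ⟩
    y k                           ∎
    where
    lower : Sum k (λ j → y j * invFact (suc k ∸ j)) ≡ Sum k (λ j → x j * invFact (suc k ∸ j))
    lower = Sum-cong k (λ j j<k → cong (_* invFact (suc k ∸ j)) (sym (below k j j<k)))

-- (−1)ᵏ βExp k and β k satisfy the same triangular recurrence (that of Sum-β-invFact).
βExp-reflection : ∀ a → βExp a ≡ signℚ a * β a
βExp-reflection a = begin
  βExp a                             ≡⟨ *-identityˡ _ ⟨
  1ℚ * βExp a                        ≡⟨ cong (_* βExp a) (signℚ-square a) ⟨
  signℚ a * signℚ a * βExp a         ≡⟨ *-assoc (signℚ a) _ _ ⟩
  signℚ a * (signℚ a * βExp a)       ≡⟨ cong (signℚ a *_) (Sum-invFact-injective (λ k → signℚ k * βExp k) β same-recurrence a) ⟩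
  signℚ a * β a                      ∎
  where
  same-recurrence : ∀ n → Sum (suc n) (λ k → signℚ k * βExp k * invFact (suc n ∸ k)) ≡ Sum (suc n) (λ k → β k * invFact (suc n ∸ k))
  same-recurrence n = trans (signed-βExp-recurrence n) (sym (Sum-β-invFact n))

-- The product of two letters

-- g_s(v) = v^{s−1}/(s−1)!, the coefficient of qᵛ in L_s(q)
letterWeight : ℕ → ℕ → ℚ
letterWeight s zero = 0ℚ
letterWeight s (suc v) = fromℕ (suc v ^ (s ∸ 1)) * invFact (s ∸ 1)

letterWeight-suc : ∀ i v → letterWeight (suc i) (suc v) ≡ expCoeff (fromℕ (suc v)) i
letterWeight-suc i v = cong (_* invFact i) (fromℕ-^ (suc v) i)

letterWeight-raise : ∀ s v → fromℕ (suc s) * letterWeight (suc (suc s)) v ≡ fromℕ v * letterWeight (suc s) v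
letterWeight-raise s zero = solve 1 (λ a → a :* con 0ℚ := con 0ℚ :* con 0ℚ) refl (fromℕ (suc s))
letterWeight-raise s (suc v) = begin
  fromℕ (suc s) * letterWeight (suc (suc s)) (suc v)     ≡⟨ cong (fromℕ (suc s) *_) (letterWeight-suc (suc s) v) ⟩
  deriv (expCoeff (fromℕ (suc v))) s                     ≡⟨ deriv-expCoeff (fromℕ (suc v)) s ⟩
  fromℕ (suc v) * expCoeff (fromℕ (suc v)) s             ≡⟨ cong (fromℕ (suc v) *_) (letterWeight-suc s v) ⟨
  fromℕ (suc v) * letterWeight (suc s) (suc v)           ∎

letterWeight-·-raise : ∀ a b m → fromℕ (suc b) * (letterWeight (suc a) · letterWeight (suc (suc b))) m
  ≡ fromℕ m * (letterWeight (suc a) · letterWeight (suc b)) m - fromℕ (suc a) * (letterWeight (suc (suc a)) · letterWeight (suc b)) m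
letterWeight-·-raise a b m = begin
  fromℕ (suc b) * (gA · letterWeight (suc (suc b))) m
    ≡⟨ cong (fromℕ (suc b) *_) (·-as-Sum gA (letterWeight (suc (suc b))) m) ⟩
  fromℕ (suc b) * Sum (suc m) (λ v → gA v * letterWeight (suc (suc b)) (m ∸ v))
    ≡⟨ *-distribˡ-Sum (suc m) (fromℕ (suc b)) _ ⟩
  Sum (suc m) (λ v → fromℕ (suc b) * (gA v * letterWeight (suc (suc b)) (m ∸ v)))
    ≡⟨ Sum-cong (suc m) term ⟩
  Sum (suc m) (λ v → fromℕ m * (gA v * gB (m ∸ v)) + - (fromℕ (suc a) * (gA′ v * gB (m ∸ v))))
    ≡⟨ Sum-distrib-+ (suc m) _ _ ⟩
  Sum (suc m) (λ v → fromℕ m * (gA v * gB (m ∸ v))) + Sum (suc m) (λ v → - (fromℕ (suc a) * (gA′ v * gB (m ∸ v))))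
    ≡⟨ cong₂ _+_ (*-distribˡ-Sum (suc m) (fromℕ m) _) (trans (cong -_ (*-distribˡ-Sum (suc m) (fromℕ (suc a)) _)) (neg-distrib-Sum (suc m) _)) ⟨
  fromℕ m * Sum (suc m) (λ v → gA v * gB (m ∸ v)) - fromℕ (suc a) * Sum (suc m) (λ v → gA′ v * gB (m ∸ v))
    ≡⟨ cong₂ (λ s t → fromℕ m * s - fromℕ (suc a) * t) (·-as-Sum gA gB m) (·-as-Sum gA′ gB m) ⟨
  fromℕ m * (gA · gB) m - fromℕ (suc a) * (gA′ · gB) m ∎
  where
  gA = letterWeight (suc a)
  gA′ = letterWeight (suc (suc a))
  gB = letterWeight (suc b)
  term : ∀ v → v < suc m →
    fromℕ (suc b) * (gA v * letterWeight (suc (suc b)) (m ∸ v)) ≡ fromℕ m * (gA v * gB (m ∸ v)) + - (fromℕ (suc a) * (gA′ v * gB (m ∸ v)))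
  term v (s≤s v≤m) = begin
    fromℕ (suc b) * (gA v * letterWeight (suc (suc b)) (m ∸ v))
      ≡⟨ solve 3 (λ x y z → x :* (y :* z) := y :* (x :* z)) refl (fromℕ (suc b)) (gA v) (letterWeight (suc (suc b)) (m ∸ v)) ⟩
    gA v * (fromℕ (suc b) * letterWeight (suc (suc b)) (m ∸ v))
      ≡⟨ cong (gA v *_) (letterWeight-raise b (m ∸ v)) ⟩
    gA v * (fromℕ (m ∸ v) * gB (m ∸ v))
      ≡⟨ cong (λ t → gA v * (t * gB (m ∸ v))) (fromℕ-∸ m v v≤m) ⟩
    gA v * ((fromℕ m - fromℕ v) * gB (m ∸ v))
      ≡⟨ solve 4 (λ x y M V → x :* ((M :- V) :* y) := M :* (x :* y) :+ :- ((V :* x) :* y)) refl (gA v) (gB (m ∸ v)) (fromℕ m) (fromℕ v) ⟩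
    fromℕ m * (gA v * gB (m ∸ v)) + - (fromℕ v * gA v * gB (m ∸ v))
      ≡⟨ cong (λ t → fromℕ m * (gA v * gB (m ∸ v)) + - (t * gB (m ∸ v))) (letterWeight-raise a v) ⟨
    fromℕ m * (gA v * gB (m ∸ v)) + - (fromℕ (suc a) * gA′ v * gB (m ∸ v))
      ≡⟨ cong (λ t → fromℕ m * (gA v * gB (m ∸ v)) + - t) (*-assoc (fromℕ (suc a)) _ _) ⟩
    fromℕ m * (gA v * gB (m ∸ v)) + - (fromℕ (suc a) * (gA′ v * gB (m ∸ v))) ∎

lam-as-β : ∀ j a b K t → a ℕ.+ b ∸ j ≡ K → a ∸ j ≡ t → lam j a b ≡ signℚ (b ∸ 1) * fromℕ ((K ∸ 1) C t) * β K
lam-as-β j a b K t refl refl = begin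
  signℚ (b ∸ 1) * (ℤ.+ ((K ∸ 1) C t) / 1) * bernoulli K * invFact K   ≡⟨ cong (λ z → signℚ (b ∸ 1) * z * bernoulli K * invFact K) (k/1≡fromℕ ((K ∸ 1) C t)) ⟩
  signℚ (b ∸ 1) * fromℕ ((K ∸ 1) C t) * bernoulli K * invFact K      ≡⟨ *-assoc (signℚ (b ∸ 1) * fromℕ ((K ∸ 1) C t)) _ _ ⟩
  signℚ (b ∸ 1) * fromℕ ((K ∸ 1) C t) * β K                          ∎

lam-diagonal : ∀ a b → lam a a b ≡ lam (suc a) (suc a) b
lam-diagonal a b = trans (lam-as-β a a b b 0 (ℕP.m+n∸m≡n a b) (ℕP.n∸n≡0 a)) (sym (lam-as-β (suc a) (suc a) b b 0 (ℕP.m+n∸m≡n a b) (ℕP.n∸n≡0 a)))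

C-raise : ∀ r q → fromℕ (suc r) * fromℕ ((r ℕ.+ suc q) C suc r) ≡ fromℕ (suc q) * fromℕ ((r ℕ.+ suc q) C r)
C-raise r q = begin
  fromℕ (suc r) * fromℕ (n C suc r)                                ≡⟨ cong (fromℕ (suc r) *_) (fromℕ-C r+1≤n) ⟩
  fromℕ (suc r) * (fromℕ (n !) * invFact (suc r) * invFact (n ∸ suc r)) ≡⟨ cong (λ z → fromℕ (suc r) * (fromℕ (n !) * invFact (suc r) * invFact z)) n∸[r+1]≡q ⟩
  fromℕ (suc r) * (fromℕ (n !) * invFact (suc r) * invFact q)      ≡⟨ solve 4 (λ a b c d → a :* (b :* c :* d) := b :* (c :* a) :* d) refl (fromℕ (suc r)) (fromℕ (n !)) (invFact (suc r)) (invFact q) ⟩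
  fromℕ (n !) * (invFact (suc r) * fromℕ (suc r)) * invFact q      ≡⟨ cong (λ z → fromℕ (n !) * z * invFact q) (invFact-suc r) ⟩
  fromℕ (n !) * invFact r * invFact q                              ≡⟨ cong (fromℕ (n !) * invFact r *_) (invFact-suc q) ⟨
  fromℕ (n !) * invFact r * (invFact (suc q) * fromℕ (suc q))      ≡⟨ solve 4 (λ a b c d → a :* b :* (c :* d) := d :* (a :* b :* c)) refl (fromℕ (n !)) (invFact r) (invFact (suc q)) (fromℕ (suc q)) ⟩
  fromℕ (suc q) * (fromℕ (n !) * invFact r * invFact (suc q))      ≡⟨ cong (λ z → fromℕ (suc q) * (fromℕ (n !) * invFact r * invFact z)) (ℕP.m+n∸m≡n r (suc q)) ⟨
  fromℕ (suc q) * (fromℕ (n !) * invFact r * invFact (n ∸ r))      ≡⟨ cong (fromℕ (suc q) *_) (fromℕ-C (ℕP.m≤m+n r (suc q))) ⟨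
  fromℕ (suc q) * fromℕ (n C r)                                    ∎
  where
  n = r ℕ.+ suc q
  r+1≤n : suc r ≤ n
  r+1≤n = subst (suc r ≤_) (sym (ℕP.+-suc r q)) (ℕP.m≤m+n (suc r) q)
  n∸[r+1]≡q : n ∸ suc r ≡ q
  n∸[r+1]≡q = trans (cong (_∸ suc r) (ℕP.+-suc r q)) (ℕP.m+n∸m≡n (suc r) q)

-- z_a ⋄ z_b with every letter z_j replaced by x^{j−1}/(j−1)!; at x = m these are the g_j(m)
diamondPoly : ℚ → ℕ → ℕ → ℚ
diamondPoly x a b = Sum a (λ i → lam (suc i) a b * expCoeff x i) + Sum b (λ i → lam (suc i) b a * expCoeff x i) + expCoeff x (a ℕ.+ b ∸ 1)

shiftCoeff : (ℕ → ℚ) → ℕ → ℚ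
shiftCoeff L zero = 0ℚ
shiftCoeff L (suc i) = fromℕ (suc i) * L i

*-Sum-expCoeff : ∀ x n (L : ℕ → ℚ) → x * Sum n (λ i → L i * expCoeff x i) ≡ Sum (suc n) (λ i → shiftCoeff L i * expCoeff x i)
*-Sum-expCoeff x n L = begin
  x * Sum n (λ i → L i * expCoeff x i)                            ≡⟨ *-distribˡ-Sum n x _ ⟩
  Sum n (λ i → x * (L i * expCoeff x i))                          ≡⟨ Sum-cong-≗ n term ⟩
  Sum n (λ i → shiftCoeff L (suc i) * expCoeff x (suc i))         ≡⟨ Sum-head-0 n _ (*-zeroˡ (expCoeff x 0)) ⟨
  Sum (suc n) (λ i → shiftCoeff L i * expCoeff x i)               ∎
  where
  term : ∀ i → x * (L i * expCoeff x i) ≡ shiftCoeff L (suc i) * expCoeff x (suc i)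
  term i = begin
    x * (L i * expCoeff x i)                        ≡⟨ solve 3 (λ X l E → X :* (l :* E) := l :* (X :* E)) refl x (L i) (expCoeff x i) ⟩
    L i * (x * expCoeff x i)                        ≡⟨ cong (L i *_) (deriv-expCoeff x i) ⟨
    L i * (fromℕ (suc i) * expCoeff x (suc i))      ≡⟨ solve 3 (λ l a E → l :* (a :* E) := a :* l :* E) refl (L i) (fromℕ (suc i)) (expCoeff x (suc i)) ⟩
    fromℕ (suc i) * L i * expCoeff x (suc i)        ∎

m≡n+o⇒m∸n≡o : ∀ n o m → m ≡ n ℕ.+ o → m ∸ n ≡ o
m≡n+o⇒m∸n≡o n o m eq = trans (cong (_∸ n) eq) (ℕP.m+n∸m≡n n o)

shiftCoeff-lam : ∀ i r q → shiftCoeff (λ j → lam (suc j) (i ℕ.+ suc r) (suc q)) i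
  ≡ fromℕ i * (signℚ q * fromℕ ((r ℕ.+ suc q) C suc r) * β (suc (r ℕ.+ suc q)))
shiftCoeff-lam zero r q = sym (*-zeroˡ (signℚ q * fromℕ ((r ℕ.+ suc q) C suc r) * β (suc (r ℕ.+ suc q))))
shiftCoeff-lam (suc i) r q = cong (fromℕ (suc i) *_) (lam-as-β (suc i) (suc i ℕ.+ suc r) (suc q) (suc (r ℕ.+ suc q)) (suc r)
  (m≡n+o⇒m∸n≡o (suc i) (suc (r ℕ.+ suc q)) _ (ℕP.+-assoc (suc i) (suc r) (suc q)))
  (ℕP.m+n∸m≡n (suc i) (suc r)))

lam-left-raise : ∀ i r q → let a = i ℕ.+ suc r in
  shiftCoeff (λ j → lam (suc j) a (suc q)) i - fromℕ a * lam (suc i) (suc a) (suc q) ≡ fromℕ (suc q) * lam (suc i) a (suc (suc q))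
lam-left-raise i r q = begin
  shiftCoeff (λ j → lam (suc j) a (suc q)) i - fromℕ a * lam (suc i) (suc a) (suc q)
    ≡⟨ cong₂ (λ u w → u - fromℕ a * w) (shiftCoeff-lam i r q) (lam-as-β (suc i) (suc a) (suc q) K (suc r) K₂ (ℕP.m+n∸m≡n i (suc r))) ⟩
  fromℕ i * Y - fromℕ a * Y
    ≡⟨ cong (λ z → fromℕ i * Y - z * Y) (fromℕ-+ i (suc r)) ⟩
  fromℕ i * Y - (fromℕ i + fromℕ (suc r)) * Y
    ≡⟨ solve 5 (λ I R s c B → I :* (s :* c :* B) :- (I :+ R) :* (s :* c :* B) := :- (s :* (R :* c) :* B)) refl (fromℕ i) (fromℕ (suc r)) (signℚ q) Cs (β K) ⟩
  - (signℚ q * (fromℕ (suc r) * Cs) * β K)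
    ≡⟨ cong (λ z → - (signℚ q * z * β K)) (C-raise r q) ⟩
  - (signℚ q * (fromℕ (suc q) * Cr) * β K)
    ≡⟨ solve 4 (λ s b c B → :- (s :* (b :* c) :* B) := b :* (:- s :* c :* B)) refl (signℚ q) (fromℕ (suc q)) Cr (β K) ⟩
  fromℕ (suc q) * (signℚ (suc q) * Cr * β K)
    ≡⟨ cong (fromℕ (suc q) *_) (lam-as-β (suc i) a (suc (suc q)) K r K₁ (m≡n+o⇒m∸n≡o (suc i) r _ (ℕP.+-suc i r))) ⟨
  fromℕ (suc q) * lam (suc i) a (suc (suc q)) ∎
  where
  a = i ℕ.+ suc r
  K = suc (r ℕ.+ suc q)
  Cs = fromℕ ((r ℕ.+ suc q) C suc r)
  Cr = fromℕ ((r ℕ.+ suc q) C r)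
  Y = signℚ q * Cs * β K
  K₁ : a ℕ.+ suc (suc q) ∸ suc i ≡ K
  K₁ = m≡n+o⇒m∸n≡o (suc i) K _ (solveℕ 3 (λ i r q → i :+ℕ (conℕ 1 :+ℕ r) :+ℕ (conℕ 2 :+ℕ q) :=ℕ (conℕ 1 :+ℕ i) :+ℕ (conℕ 1 :+ℕ (r :+ℕ (conℕ 1 :+ℕ q)))) refl i r q)
  K₂ : suc a ℕ.+ suc q ∸ suc i ≡ K
  K₂ = m≡n+o⇒m∸n≡o (suc i) K _ (solveℕ 3 (λ i r q → conℕ 1 :+ℕ (i :+ℕ (conℕ 1 :+ℕ r)) :+ℕ (conℕ 1 :+ℕ q) :=ℕ (conℕ 1 :+ℕ i) :+ℕ (conℕ 1 :+ℕ (r :+ℕ (conℕ 1 :+ℕ q)))) refl i r q)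

lam-right-raise : ∀ i s p → let b = i ℕ.+ suc s in
  shiftCoeff (λ j → lam (suc j) b (suc p)) i - fromℕ (suc p) * lam (suc i) b (suc (suc p)) ≡ fromℕ b * lam (suc i) (suc b) (suc p)
lam-right-raise i s p = begin
  shiftCoeff (λ j → lam (suc j) b (suc p)) i - fromℕ (suc p) * lam (suc i) b (suc (suc p))
    ≡⟨ cong₂ (λ u w → u - fromℕ (suc p) * w) (shiftCoeff-lam i s p) (lam-as-β (suc i) b (suc (suc p)) K s K₁ (m≡n+o⇒m∸n≡o (suc i) s _ (ℕP.+-suc i s))) ⟩
  fromℕ i * Z - fromℕ (suc p) * (signℚ (suc p) * Cr * β K)
    ≡⟨ solve 6 (λ I A s cs cr B → I :* (s :* cs :* B) :- A :* (:- s :* cr :* B) := I :* (s :* cs :* B) :+ s :* (A :* cr) :* B) refl (fromℕ i) (fromℕ (suc p)) (signℚ p) Cs Cr (β K) ⟩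
  fromℕ i * Z + signℚ p * (fromℕ (suc p) * Cr) * β K
    ≡⟨ cong (λ z → fromℕ i * Z + signℚ p * z * β K) (C-raise s p) ⟨
  fromℕ i * Z + signℚ p * (fromℕ (suc s) * Cs) * β K
    ≡⟨ solve 5 (λ I S s cs B → I :* (s :* cs :* B) :+ s :* (S :* cs) :* B := (I :+ S) :* (s :* cs :* B)) refl (fromℕ i) (fromℕ (suc s)) (signℚ p) Cs (β K) ⟩
  (fromℕ i + fromℕ (suc s)) * Z
    ≡⟨ cong (_* Z) (fromℕ-+ i (suc s)) ⟨
  fromℕ b * Z
    ≡⟨ cong (fromℕ b *_) (lam-as-β (suc i) (suc b) (suc p) K (suc s) K₂ (ℕP.m+n∸m≡n i (suc s))) ⟨
  fromℕ b * lam (suc i) (suc b) (suc p) ∎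
  where
  b = i ℕ.+ suc s
  K = suc (s ℕ.+ suc p)
  Cs = fromℕ ((s ℕ.+ suc p) C suc s)
  Cr = fromℕ ((s ℕ.+ suc p) C s)
  Z = signℚ p * Cs * β K
  K₁ : b ℕ.+ suc (suc p) ∸ suc i ≡ K
  K₁ = m≡n+o⇒m∸n≡o (suc i) K _ (solveℕ 3 (λ i s p → i :+ℕ (conℕ 1 :+ℕ s) :+ℕ (conℕ 2 :+ℕ p) :=ℕ (conℕ 1 :+ℕ i) :+ℕ (conℕ 1 :+ℕ (s :+ℕ (conℕ 1 :+ℕ p)))) refl i s p)
  K₂ : suc b ℕ.+ suc p ∸ suc i ≡ K
  K₂ = m≡n+o⇒m∸n≡o (suc i) K _ (solveℕ 3 (λ i s p → conℕ 1 :+ℕ (i :+ℕ (conℕ 1 :+ℕ s)) :+ℕ (conℕ 1 :+ℕ p) :=ℕ (conℕ 1 :+ℕ i) :+ℕ (conℕ 1 :+ℕ (s :+ℕ (conℕ 1 :+ℕ p)))) refl i s p)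

Sum-combine : ∀ n (u w E : ℕ → ℚ) c → Sum n (λ i → u i * E i) - c * Sum n (λ i → w i * E i) ≡ Sum n (λ i → (u i - c * w i) * E i)
Sum-combine n u w E c = begin
  Sum n (λ i → u i * E i) - c * Sum n (λ i → w i * E i)      ≡⟨ cong (λ z → Sum n (λ i → u i * E i) - z) (*-distribˡ-Sum n c _) ⟩
  Sum n (λ i → u i * E i) - Sum n (λ i → c * (w i * E i))    ≡⟨ cong (Sum n (λ i → u i * E i) +_) (neg-distrib-Sum n _) ⟩
  Sum n (λ i → u i * E i) + Sum n (λ i → - (c * (w i * E i))) ≡⟨ Sum-distrib-+ n _ _ ⟨
  Sum n (λ i → u i * E i + - (c * (w i * E i)))              ≡⟨ Sum-cong-≗ n (λ i → solve 4 (λ U W X C → U :* X :+ :- (C :* (W :* X)) := (U :- C :* W) :* X) refl (u i) (w i) (E i) c) ⟩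
  Sum n (λ i → (u i - c * w i) * E i)                        ∎

i<1+n⇒1+n≡i+[1+[n∸i]] : ∀ {i n} → i < suc n → suc n ≡ i ℕ.+ suc (n ∸ i)
i<1+n⇒1+n≡i+[1+[n∸i]] {i} {n} (s≤s i≤n) = sym (trans (ℕP.+-suc i (n ∸ i)) (cong suc (ℕP.m+[n∸m]≡n i≤n)))

diamondPoly-left-raise : ∀ x p q → fromℕ (suc q) * Sum (suc p) (λ i → lam (suc i) (suc p) (suc (suc q)) * expCoeff x i)
  ≡ x * Sum (suc p) (λ i → lam (suc i) (suc p) (suc q) * expCoeff x i) - fromℕ (suc p) * Sum (suc (suc p)) (λ i → lam (suc i) (suc (suc p)) (suc q) * expCoeff x i)
diamondPoly-left-raise x p q = sym (begin
  x * Sum a (λ i → L i * E i) - fromℕ a * Sum (suc a) (λ i → M i * E i)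
    ≡⟨ cong (_- fromℕ a * Sum (suc a) (λ i → M i * E i)) (*-Sum-expCoeff x a L) ⟩
  Sum (suc a) (λ i → shiftCoeff L i * E i) - fromℕ a * Sum (suc a) (λ i → M i * E i)
    ≡⟨ Sum-combine (suc a) (shiftCoeff L) M E (fromℕ a) ⟩
  Sum a (λ i → (shiftCoeff L i - fromℕ a * M i) * E i) + (shiftCoeff L a - fromℕ a * M a) * E a
    ≡⟨ cong₂ _+_ (Sum-cong a (λ i i<a → cong (_* E i) (coeff i i<a))) (trans (cong (_* E a) top) (*-zeroˡ (E a))) ⟩
  Sum a (λ i → fromℕ b * lam (suc i) a (suc b) * E i) + 0ℚ
    ≡⟨ +-identityʳ _ ⟩
  Sum a (λ i → fromℕ b * lam (suc i) a (suc b) * E i)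
    ≡⟨ trans (Sum-cong-≗ a (λ i → *-assoc (fromℕ b) _ _)) (sym (*-distribˡ-Sum a (fromℕ b) _)) ⟩
  fromℕ b * Sum a (λ i → lam (suc i) a (suc b) * E i) ∎)
  where
  a = suc p
  b = suc q
  E = expCoeff x
  L = λ j → lam (suc j) a b
  M = λ j → lam (suc j) (suc a) b
  coeff : ∀ i → i < a → shiftCoeff L i - fromℕ a * M i ≡ fromℕ b * lam (suc i) a (suc b)
  coeff i i<a = subst (λ a → shiftCoeff (λ j → lam (suc j) a b) i - fromℕ a * lam (suc i) (suc a) b ≡ fromℕ b * lam (suc i) a (suc b))
    (sym (i<1+n⇒1+n≡i+[1+[n∸i]] i<a)) (lam-left-raise i (p ∸ i) q)
  top : shiftCoeff L a - fromℕ a * M a ≡ 0ℚ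
  top = trans (cong (λ z → fromℕ a * z - fromℕ a * M a) (lam-diagonal a b)) (+-inverseʳ (fromℕ a * M a))

diamondPoly-right-raise : ∀ x p q → fromℕ (suc q) * Sum (suc (suc q)) (λ i → lam (suc i) (suc (suc q)) (suc p) * expCoeff x i)
  ≡ x * Sum (suc q) (λ i → lam (suc i) (suc q) (suc p) * expCoeff x i) - fromℕ (suc p) * Sum (suc q) (λ i → lam (suc i) (suc q) (suc (suc p)) * expCoeff x i)
diamondPoly-right-raise x p q = sym (begin
  x * Sum b (λ i → L i * E i) - fromℕ a * Sum b (λ i → d i * E i)
    ≡⟨ cong (_- fromℕ a * Sum b (λ i → d i * E i)) (*-Sum-expCoeff x b L) ⟩
  Sum b (λ i → shiftCoeff L i * E i) + shiftCoeff L b * E b - fromℕ a * Sum b (λ i → d i * E i)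
    ≡⟨ solve 3 (λ S T U → S :+ T :- U := S :- U :+ T) refl (Sum b (λ i → shiftCoeff L i * E i)) (shiftCoeff L b * E b) (fromℕ a * Sum b (λ i → d i * E i)) ⟩
  Sum b (λ i → shiftCoeff L i * E i) - fromℕ a * Sum b (λ i → d i * E i) + shiftCoeff L b * E b
    ≡⟨ cong (_+ shiftCoeff L b * E b) (Sum-combine b (shiftCoeff L) d E (fromℕ a)) ⟩
  Sum b (λ i → (shiftCoeff L i - fromℕ a * d i) * E i) + shiftCoeff L b * E b
    ≡⟨ cong₂ _+_ (Sum-cong b (λ i i<b → cong (_* E i) (coeff i i<b))) (cong (λ z → fromℕ b * z * E b) (lam-diagonal b a)) ⟩
  Sum b (λ i → fromℕ b * lam (suc i) (suc b) a * E i) + fromℕ b * lam (suc b) (suc b) a * E b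
    ≡⟨ cong₂ _+_ (trans (Sum-cong-≗ b (λ i → *-assoc (fromℕ b) _ _)) (sym (*-distribˡ-Sum b (fromℕ b) _))) (*-assoc (fromℕ b) _ _) ⟩
  fromℕ b * Sum b (λ i → lam (suc i) (suc b) a * E i) + fromℕ b * (lam (suc b) (suc b) a * E b)
    ≡⟨ *-distribˡ-+ (fromℕ b) _ _ ⟨
  fromℕ b * Sum (suc b) (λ i → lam (suc i) (suc b) a * E i) ∎)
  where
  a = suc p
  b = suc q
  E = expCoeff x
  L = λ j → lam (suc j) b a
  d = λ j → lam (suc j) b (suc a)
  coeff : ∀ i → i < b → shiftCoeff L i - fromℕ a * d i ≡ fromℕ b * lam (suc i) (suc b) a
  coeff i i<b = subst (λ b → shiftCoeff (λ j → lam (suc j) b a) i - fromℕ a * lam (suc i) b (suc a) ≡ fromℕ b * lam (suc i) (suc b) a)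
    (sym (i<1+n⇒1+n≡i+[1+[n∸i]] i<b)) (lam-right-raise i (q ∸ i) p)

diamondPoly-top-raise : ∀ x p q → fromℕ (suc q) * expCoeff x (p ℕ.+ suc (suc q)) ≡ x * expCoeff x (p ℕ.+ suc q) - fromℕ (suc p) * expCoeff x (suc (p ℕ.+ suc q))
diamondPoly-top-raise x p q = begin
  fromℕ b * expCoeff x (p ℕ.+ suc b)              ≡⟨ cong (λ z → fromℕ b * expCoeff x z) (ℕP.+-suc p b) ⟩
  fromℕ b * E                                    ≡⟨ solve 3 (λ B A X → B :* X := (A :+ B) :* X :- A :* X) refl (fromℕ b) (fromℕ a) E ⟩
  (fromℕ a + fromℕ b) * E - fromℕ a * E          ≡⟨ cong (λ z → z * E - fromℕ a * E) (fromℕ-+ a b) ⟨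
  fromℕ (suc (p ℕ.+ b)) * E - fromℕ a * E        ≡⟨ cong (_- fromℕ a * E) (deriv-expCoeff x (p ℕ.+ b)) ⟩
  x * expCoeff x (p ℕ.+ b) - fromℕ a * E         ∎
  where
  a = suc p
  b = suc q
  E = expCoeff x (suc (p ℕ.+ b))

diamondPoly-raise : ∀ x p q → fromℕ (suc q) * diamondPoly x (suc p) (suc (suc q))
  ≡ x * diamondPoly x (suc p) (suc q) - fromℕ (suc p) * diamondPoly x (suc (suc p)) (suc q)
diamondPoly-raise x p q = begin
  fromℕ b * (S₁ + S₂ + S₃)
    ≡⟨ solve 4 (λ B u v w → B :* (u :+ v :+ w) := B :* u :+ B :* v :+ B :* w) refl (fromℕ b) S₁ S₂ S₃ ⟩
  fromℕ b * S₁ + fromℕ b * S₂ + fromℕ b * S₃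
    ≡⟨ cong₂ _+_ (cong₂ _+_ (diamondPoly-left-raise x p q) (diamondPoly-right-raise x p q)) (diamondPoly-top-raise x p q) ⟩
  (x * T₁ - fromℕ a * U₁) + (x * T₂ - fromℕ a * U₂) + (x * T₃ - fromℕ a * U₃)
    ≡⟨ solve 8 (λ X A s₁ s₂ s₃ t₁ t₂ t₃ → (X :* s₁ :- A :* t₁) :+ (X :* s₂ :- A :* t₂) :+ (X :* s₃ :- A :* t₃) := X :* (s₁ :+ s₂ :+ s₃) :- A :* (t₁ :+ t₂ :+ t₃)) refl x (fromℕ a) T₁ T₂ T₃ U₁ U₂ U₃ ⟩
  x * (T₁ + T₂ + T₃) - fromℕ a * (U₁ + U₂ + U₃) ∎
  where
  a = suc p
  b = suc q
  S₁ = Sum a (λ i → lam (suc i) a (suc b) * expCoeff x i)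
  S₂ = Sum (suc b) (λ i → lam (suc i) (suc b) a * expCoeff x i)
  S₃ = expCoeff x (p ℕ.+ suc b)
  T₁ = Sum a (λ i → lam (suc i) a b * expCoeff x i)
  T₂ = Sum b (λ i → lam (suc i) b a * expCoeff x i)
  T₃ = expCoeff x (p ℕ.+ b)
  U₁ = Sum (suc a) (λ i → lam (suc i) (suc a) b * expCoeff x i)
  U₂ = Sum b (λ i → lam (suc i) b (suc a) * expCoeff x i)
  U₃ = expCoeff x (suc (p ℕ.+ b))

-- B_{p+1}(x)/(p+1)!
bernoulliPoly : ℚ → ℕ → ℚ
bernoulliPoly x p = Sum (suc (suc p)) (λ j → β (suc p ∸ j) * expCoeff x j)

βTail : ℕ → ℚ
βTail L = Sum L (λ s → β (L ∸ suc s) * invFact (suc s))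

βTail-suc : ∀ n → βTail (suc n) ≡ 𝟙 n
βTail-suc n = begin
  βTail (suc n)                                             ≡⟨ Sum-reverse (suc n) _ ⟩
  Sum (suc n) (λ i → β (n ∸ (n ∸ i)) * invFact (suc (n ∸ i))) ≡⟨ Sum-cong (suc n) unreverse ⟩
  Sum (suc n) (λ i → β i * invFact (suc n ∸ i))             ≡⟨ Sum-β-invFact n ⟩
  𝟙 n                                                       ∎
  where
  unreverse : ∀ i → i < suc n → β (n ∸ (n ∸ i)) * invFact (suc (n ∸ i)) ≡ β i * invFact (suc n ∸ i)
  unreverse i (s≤s i≤n) = cong₂ (λ u w → β u * invFact w) (ℕP.m∸[m∸n]≡n i≤n) (sym (ℕP.+-∸-assoc 1 i≤n))

bernoulliPoly-step : ∀ x p → bernoulliPoly (1ℚ + x) p ≡ bernoulliPoly x p + expCoeff x p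
bernoulliPoly-step x p = begin
  bernoulliPoly (1ℚ + x) p
    ≡⟨ Sum-cong-≗ N (λ j → cong (β (suc p ∸ j) *_) (trans (expCoeff-+ 1ℚ x j) (·-comm (expCoeff 1ℚ) (expCoeff x) j))) ⟩
  Sum N (λ j → β (suc p ∸ j) * (expCoeff x · expCoeff 1ℚ) j)
    ≡⟨ Sum-cong-≗ N (λ j → trans (cong (β (suc p ∸ j) *_) (·-as-Sum (expCoeff x) (expCoeff 1ℚ) j)) (*-distribˡ-Sum (suc j) (β (suc p ∸ j)) _)) ⟩
  Sum N (λ j → Sum (suc j) (λ k → T k j))                         ≡⟨ Sum-triangle (suc p) T ⟩
  Sum N (λ k → Sum (suc (suc p ∸ k)) (λ s → T k (k ℕ.+ s)))       ≡⟨ Sum-cong-≗ N row ⟩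
  Sum N (λ k → β (suc p ∸ k) * expCoeff x k + expCoeff x k * βTail (suc p ∸ k)) ≡⟨ Sum-distrib-+ N _ _ ⟩
  bernoulliPoly x p + Sum N (λ k → expCoeff x k * βTail (suc p ∸ k)) ≡⟨ cong (bernoulliPoly x p +_) tails ⟩
  bernoulliPoly x p + expCoeff x p                                ∎
  where
  N = suc (suc p)
  T : ℕ → ℕ → ℚ
  T k j = β (suc p ∸ j) * (expCoeff x k * expCoeff 1ℚ (j ∸ k))
  row : ∀ k → Sum (suc (suc p ∸ k)) (λ s → T k (k ℕ.+ s)) ≡ β (suc p ∸ k) * expCoeff x k + expCoeff x k * βTail (suc p ∸ k)
  row k = begin
    Sum (suc L) (λ s → T k (k ℕ.+ s))
      ≡⟨ Sum-cong-≗ (suc L) (λ s → trans (cong₂ (λ u w → β u * (expCoeff x k * expCoeff 1ℚ w)) (sym (ℕP.∸-+-assoc (suc p) k s)) (ℕP.m+n∸m≡n k s))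
          (trans (cong (λ z → β (L ∸ s) * (expCoeff x k * z)) (expCoeff-1 s)) (solve 3 (λ B E I → B :* (E :* I) := E :* (B :* I)) refl (β (L ∸ s)) (expCoeff x k) (invFact s)))) ⟩
    Sum (suc L) (λ s → expCoeff x k * (β (L ∸ s) * invFact s))   ≡⟨ *-distribˡ-Sum (suc L) (expCoeff x k) _ ⟨
    expCoeff x k * Sum (suc L) (λ s → β (L ∸ s) * invFact s)     ≡⟨ cong (expCoeff x k *_) (trans (Sum-head L _) (cong (_+ βTail L) (*-identityʳ (β L)))) ⟩
    expCoeff x k * (β L + βTail L)                               ≡⟨ solve 3 (λ E B v → E :* (B :+ v) := B :* E :+ E :* v) refl (expCoeff x k) (β L) (βTail L) ⟩
    β L * expCoeff x k + expCoeff x k * βTail L                  ∎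
    where L = suc p ∸ k
  βTail-vanishes : ∀ k → k < p → βTail (suc (p ∸ k)) ≡ 0ℚ
  βTail-vanishes k k<p = trans (βTail-suc (p ∸ k)) (𝟙-≢0 (ℕP.m>n⇒m∸n≢0 k<p))
  tails : Sum N (λ k → expCoeff x k * βTail (suc p ∸ k)) ≡ expCoeff x p
  tails = begin
    Sum N (λ k → expCoeff x k * βTail (suc p ∸ k))
      ≡⟨ Sum-last-0 (suc p) _ (trans (cong (λ z → expCoeff x (suc p) * βTail z) (ℕP.n∸n≡0 p)) (*-zeroʳ (expCoeff x (suc p)))) ⟩
    Sum (suc p) (λ k → expCoeff x k * βTail (suc p ∸ k))
      ≡⟨ Sum-cong (suc p) (λ k k<1+p → cong (λ z → expCoeff x k * βTail z) (ℕP.+-∸-assoc 1 (ℕP.≤-pred k<1+p))) ⟩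
    Sum p (λ k → expCoeff x k * βTail (suc (p ∸ k))) + expCoeff x p * βTail (suc (p ∸ p))
      ≡⟨ cong₂ _+_ (Sum-zeros p _ (λ k k<p → trans (cong (expCoeff x k *_) (βTail-vanishes k k<p)) (*-zeroʳ (expCoeff x k))))
                   (trans (cong (λ z → expCoeff x p * βTail (suc z)) (ℕP.n∸n≡0 p)) (*-identityʳ (expCoeff x p))) ⟩
    0ℚ + expCoeff x p
      ≡⟨ +-identityˡ _ ⟩
    expCoeff x p ∎

bernoulliPoly-1 : ∀ p → bernoulliPoly 1ℚ p + signℚ p * β (suc p) ≡ 0ℚ
bernoulliPoly-1 p = begin
  bernoulliPoly 1ℚ p + σβ                                          ≡⟨ cong (_+ σβ) (Sum-cong-≗ N (λ j → cong (β (suc p ∸ j) *_) (expCoeff-1 j))) ⟩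
  Sum N (λ j → β (suc p ∸ j) * invFact j) + σβ                    ≡⟨ cong (_+ σβ) (Sum-reverse N _) ⟩
  Sum N (λ i → β (suc p ∸ (suc p ∸ i)) * invFact (suc p ∸ i)) + σβ ≡⟨ cong (_+ σβ) (Sum-cong N (λ i i<N → cong (λ z → β z * invFact (suc p ∸ i)) (ℕP.m∸[m∸n]≡n (ℕP.≤-pred i<N)))) ⟩
  βExp (suc p) + σβ                                               ≡⟨ cong (_+ σβ) (βExp-reflection (suc p)) ⟩
  - signℚ p * β (suc p) + σβ                                      ≡⟨ solve 2 (λ s b → :- s :* b :+ s :* b := con 0ℚ) refl (signℚ p) (β (suc p)) ⟩
  0ℚ                                                              ∎
  where
  N = suc (suc p)
  σβ = signℚ p * β (suc p)

diamondPoly-1 : ∀ x p → diamondPoly x (suc p) 1 ≡ bernoulliPoly x p + signℚ p * β (suc p)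
diamondPoly-1 x p = begin
  Sum (suc p) (λ i → lam (suc i) (suc p) 1 * E i) + (0ℚ + lam 1 1 (suc p) * E 0) + E (p ℕ.+ 1)
    ≡⟨ cong₂ _+_ (cong₂ _+_ (Sum-cong (suc p) first) (trans (+-identityˡ _) middle)) (cong E (ℕP.+-comm p 1)) ⟩
  Sum (suc p) (λ i → β (suc p ∸ i) * E i) + σβ + E (suc p)
    ≡⟨ solve 3 (λ S T X → S :+ T :+ X := S :+ con 1ℚ :* X :+ T) refl (Sum (suc p) (λ i → β (suc p ∸ i) * E i)) σβ (E (suc p)) ⟩
  Sum (suc p) (λ i → β (suc p ∸ i) * E i) + 1ℚ * E (suc p) + σβ
    ≡⟨ cong (λ z → Sum (suc p) (λ i → β (suc p ∸ i) * E i) + β z * E (suc p) + σβ) (ℕP.n∸n≡0 p) ⟨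
  bernoulliPoly x p + σβ ∎
  where
  E = expCoeff x
  σβ = signℚ p * β (suc p)
  first : ∀ i → i < suc p → lam (suc i) (suc p) 1 * E i ≡ β (suc p ∸ i) * E i
  first i (s≤s i≤p) = cong (_* E i) (begin
    lam (suc i) (suc p) 1                                 ≡⟨ lam-as-β (suc i) (suc p) 1 (suc p ∸ i) (p ∸ i) (cong (_∸ i) (ℕP.+-comm p 1)) refl ⟩
    1ℚ * fromℕ ((suc p ∸ i ∸ 1) C (p ∸ i)) * β (suc p ∸ i) ≡⟨ cong (λ z → 1ℚ * fromℕ ((z ∸ 1) C (p ∸ i)) * β (suc p ∸ i)) (ℕP.+-∸-assoc 1 i≤p) ⟩
    1ℚ * fromℕ ((p ∸ i) C (p ∸ i)) * β (suc p ∸ i)        ≡⟨ cong (λ z → 1ℚ * fromℕ z * β (suc p ∸ i)) (nCn≡1 (p ∸ i)) ⟩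
    1ℚ * fromℕ 1 * β (suc p ∸ i)                          ≡⟨ cong (λ z → 1ℚ * z * β (suc p ∸ i)) fromℕ-1 ⟩
    1ℚ * 1ℚ * β (suc p ∸ i)                               ≡⟨ solve 1 (λ b → con 1ℚ :* con 1ℚ :* b := b) refl (β (suc p ∸ i)) ⟩
    β (suc p ∸ i)                                         ∎)
  middle : lam 1 1 (suc p) * E 0 ≡ σβ
  middle = trans (cong (_* E 0) (lam-as-β 1 1 (suc p) (suc p) 0 refl refl))
    (trans (cong (λ z → signℚ p * z * β (suc p) * E 0) fromℕ-1) (solve 2 (λ s b → s :* con 1ℚ :* b :* con 1ℚ := s :* b) refl (signℚ p) (β (suc p))))

powerSum : ℕ → ℕ → ℚ
powerSum p m = Sum m (λ v → expCoeff (fromℕ (suc v)) p)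

letterWeight-·-1 : ∀ p m → (letterWeight (suc p) · letterWeight 1) (suc m) ≡ powerSum p m
letterWeight-·-1 p m = begin
  (letterWeight (suc p) · letterWeight 1) (suc m)                      ≡⟨ ·-as-Sum (letterWeight (suc p)) (letterWeight 1) (suc m) ⟩
  Sum (suc (suc m)) (λ v → letterWeight (suc p) v * letterWeight 1 (suc m ∸ v))
    ≡⟨ Sum-last-0 (suc m) _ (trans (cong (λ z → letterWeight (suc p) (suc m) * letterWeight 1 z) (ℕP.n∸n≡0 m)) (*-zeroʳ (letterWeight (suc p) (suc m)))) ⟩
  Sum (suc m) (λ v → letterWeight (suc p) v * letterWeight 1 (suc m ∸ v))
    ≡⟨ Sum-cong (suc m) (λ v v<1+m → trans (cong (λ z → letterWeight (suc p) v * letterWeight 1 z) (ℕP.+-∸-assoc 1 (ℕP.≤-pred v<1+m))) (*-identityʳ _)) ⟩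
  Sum (suc m) (letterWeight (suc p))                                   ≡⟨ Sum-head-0 m _ refl ⟩
  Sum m (λ v → letterWeight (suc p) (suc v))                           ≡⟨ Sum-cong-≗ m (λ v → letterWeight-suc p v) ⟩
  powerSum p m                                                         ∎

faulhaber : ∀ p m → powerSum p m ≡ bernoulliPoly (fromℕ (suc m)) p + signℚ p * β (suc p)
faulhaber p zero = trans (sym (bernoulliPoly-1 p)) (cong (λ z → bernoulliPoly z p + signℚ p * β (suc p)) (sym fromℕ-1))
faulhaber p (suc m) = begin
  powerSum p m + expCoeff x p                                   ≡⟨ cong (_+ expCoeff x p) (faulhaber p m) ⟩
  bernoulliPoly x p + signℚ p * β (suc p) + expCoeff x p        ≡⟨ solve 3 (λ a b c → a :+ b :+ c := a :+ c :+ b) refl (bernoulliPoly x p) (signℚ p * β (suc p)) (expCoeff x p) ⟩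
  bernoulliPoly x p + expCoeff x p + signℚ p * β (suc p)        ≡⟨ cong (_+ signℚ p * β (suc p)) (bernoulliPoly-step x p) ⟨
  bernoulliPoly (1ℚ + x) p + signℚ p * β (suc p)                ∎
  where x = fromℕ (suc m)

-- Induction on b: both sides satisfy the recurrences letterWeight-·-raise and diamondPoly-raise,
-- and b = 1 is Faulhaber's formula.
letterWeight-·≡diamondPoly : ∀ a b m → (letterWeight (suc a) · letterWeight (suc b)) (suc m) ≡ diamondPoly (fromℕ (suc m)) (suc a) (suc b)
letterWeight-·≡diamondPoly a zero m = trans (letterWeight-·-1 a m) (trans (faulhaber a m) (sym (diamondPoly-1 (fromℕ (suc m)) a)))
letterWeight-·≡diamondPoly a (suc b) m = *-cancelˡ-fromℕ-suc b (begin
  fromℕ (suc b) * (letterWeight (suc a) · letterWeight (suc (suc b))) (suc m)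
    ≡⟨ letterWeight-·-raise a b (suc m) ⟩
  x * (letterWeight (suc a) · letterWeight (suc b)) (suc m) - fromℕ (suc a) * (letterWeight (suc (suc a)) · letterWeight (suc b)) (suc m)
    ≡⟨ cong₂ (λ u w → x * u - fromℕ (suc a) * w) (letterWeight-·≡diamondPoly a b m) (letterWeight-·≡diamondPoly (suc a) b m) ⟩
  x * diamondPoly x (suc a) (suc b) - fromℕ (suc a) * diamondPoly x (suc (suc a)) (suc b)
    ≡⟨ diamondPoly-raise x a b ⟨
  fromℕ (suc b) * diamondPoly x (suc a) (suc (suc b)) ∎)
  where x = fromℕ (suc m)

evalLCA : LCA → (ℕ → ℚ) → ℚ
evalLCA [] h = 0ℚ
evalLCA ((c , l) ∷ ls) h = c * h l + evalLCA ls h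

evalLCA-++ : ∀ xs ys h → evalLCA (xs ++ ys) h ≡ evalLCA xs h + evalLCA ys h
evalLCA-++ [] ys h = sym (+-identityˡ _)
evalLCA-++ ((c , l) ∷ xs) ys h = trans (cong (c * h l +_) (evalLCA-++ xs ys h)) (sym (+-assoc (c * h l) _ _))

evalLCA-cong : ∀ ls {h h′ : ℕ → ℚ} → (∀ l → h l ≡ h′ l) → evalLCA ls h ≡ evalLCA ls h′
evalLCA-cong [] eq = refl
evalLCA-cong ((c , l) ∷ ls) eq = cong₂ (λ a b → c * a + b) (eq l) (evalLCA-cong ls eq)

evalLCA-zero : ∀ ls h → (∀ l → h l ≡ 0ℚ) → evalLCA ls h ≡ 0ℚ
evalLCA-zero [] h h≡0 = refl
evalLCA-zero ((c , l) ∷ ls) h h≡0 = trans (cong₂ (λ u w → c * u + w) (h≡0 l) (evalLCA-zero ls h h≡0)) (solve 1 (λ c → c :* con 0ℚ :+ con 0ℚ := con 0ℚ) refl c)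

evalLCA-range1 : ∀ n (f : ℕ → ℚ) h → evalLCA (map (λ j → (f j , j)) (range1 n)) h ≡ Sum n (λ i → f (suc i) * h (suc i))
evalLCA-range1 n f h = go n (λ i → i)
  where
  go : ∀ n (t : ℕ → ℕ) → evalLCA (map (λ j → (f j , j)) (map suc (applyUpTo t n))) h ≡ Sum n (λ i → f (suc (t i)) * h (suc (t i)))
  go zero t = refl
  go (suc n) t = trans (cong (f (suc (t 0)) * h (suc (t 0)) +_) (go n (t ∘ suc))) (sym (Sum-head n (λ i → f (suc (t i)) * h (suc (t i)))))

evalLCA-⋄ : ∀ a b h → evalLCA (a ⋄ b) h ≡ Sum a (λ i → lam (suc i) a b * h (suc i)) + Sum b (λ i → lam (suc i) b a * h (suc i)) + h (a ℕ.+ b)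
evalLCA-⋄ a b h = begin
  evalLCA (λs a b ++ λs b a ++ top) h                      ≡⟨ evalLCA-++ (λs a b) _ h ⟩
  evalLCA (λs a b) h + evalLCA (λs b a ++ top) h           ≡⟨ cong (evalLCA (λs a b) h +_) (evalLCA-++ (λs b a) top h) ⟩
  evalLCA (λs a b) h + (evalLCA (λs b a) h + evalLCA top h) ≡⟨ cong₂ (λ u w → u + (w + evalLCA top h)) (evalLCA-range1 a (λ j → lam j a b) h) (evalLCA-range1 b (λ j → lam j b a) h) ⟩
  A + (B + (1ℚ * h (a ℕ.+ b) + 0ℚ))                        ≡⟨ solve 3 (λ A B H → A :+ (B :+ (con 1ℚ :* H :+ con 0ℚ)) := A :+ B :+ H) refl A B (h (a ℕ.+ b)) ⟩
  A + B + h (a ℕ.+ b)                                      ∎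
  where
  λs = λ a b → map (λ j → (lam j a b , j)) (range1 a)
  top = (1ℚ , a ℕ.+ b) ∷ []
  A = Sum a (λ i → lam (suc i) a b * h (suc i))
  B = Sum b (λ i → lam (suc i) b a * h (suc i))

letterWeight-·-⋄ : ∀ a b → 1 ≤ a → 1 ≤ b → ∀ m → (letterWeight a · letterWeight b) m ≡ evalLCA (a ⋄ b) (λ l → letterWeight l m)
letterWeight-·-⋄ (suc a) (suc b) _ _ zero = sym (evalLCA-zero (suc a ⋄ suc b) (λ l → letterWeight l 0) (λ l → refl))
letterWeight-·-⋄ (suc a) (suc b) _ _ (suc m) = begin
  (letterWeight (suc a) · letterWeight (suc b)) (suc m)     ≡⟨ letterWeight-·≡diamondPoly a b m ⟩
  diamondPoly (fromℕ (suc m)) (suc a) (suc b)               ≡⟨ cong₂ _+_ (cong₂ _+_ (Sum-cong-≗ (suc a) (weight (λ i → lam (suc i) (suc a) (suc b))))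
                                                                                    (Sum-cong-≗ (suc b) (weight (λ i → lam (suc i) (suc b) (suc a)))))
                                                                         (sym (letterWeight-suc (a ℕ.+ suc b) m)) ⟩
  Sum (suc a) (λ i → lam (suc i) (suc a) (suc b) * letterWeight (suc i) (suc m))
    + Sum (suc b) (λ i → lam (suc i) (suc b) (suc a) * letterWeight (suc i) (suc m))
    + letterWeight (suc a ℕ.+ suc b) (suc m)                ≡⟨ evalLCA-⋄ (suc a) (suc b) (λ l → letterWeight l (suc m)) ⟨
  evalLCA (suc a ⋄ suc b) (λ l → letterWeight l (suc m))    ∎
  where
  weight : ∀ (c : ℕ → ℚ) i → c i * expCoeff (fromℕ (suc m)) i ≡ c i * letterWeight (suc i) (suc m)
  weight c i = cong (c i *_) (sym (letterWeight-suc i m))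

-- Dilation q ↦ q^u

if-≤ᵇ-≤ : ∀ {m n} (x y : ℚ) → m ≤ n → (if m ≤ᵇ n then x else y) ≡ x
if-≤ᵇ-≤ {m} {n} x y m≤n with m ≤ᵇ n | ℕP.≤⇒≤ᵇ m≤n
... | true | _ = refl

if-≤ᵇ-> : ∀ {m n} (x y : ℚ) → n < m → (if m ≤ᵇ n then x else y) ≡ y
if-≤ᵇ-> {m} {n} x y n<m with m ≤ᵇ n in eq
... | true = ⊥-elim (ℕP.<⇒≱ n<m (ℕP.≤ᵇ⇒≤ m n (subst True (sym eq) tt)))
... | false = refl

Sum-δ-∸ : ∀ n m (h : ℕ → ℚ) → Sum (suc n) (λ k → δ m k * h (n ∸ k)) ≡ (if m ≤ᵇ n then h (n ∸ m) else 0ℚ)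
Sum-δ-∸ n m h with m ℕ.≤? n
... | yes m≤n = trans (Sum-δ (suc n) m _ (s≤s m≤n)) (sym (if-≤ᵇ-≤ _ 0ℚ m≤n))
... | no m≰n = trans (Sum-δ-≥ (suc n) m _ (ℕP.≰⇒> m≰n)) (sym (if-≤ᵇ-> _ 0ℚ (ℕP.≰⇒> m≰n)))

dilate : ℕ → (ℕ → ℚ) → Series
dilate u c k = Sum (suc k) (λ v → δ (u ℕ.* v) k * c v)

dilate-extend : ∀ u (c : ℕ → ℚ) k N → k ≤ N → dilate (suc u) c k ≡ Sum (suc N) (λ v → δ (suc u ℕ.* v) k * c v)
dilate-extend u c k N k≤N = sym (Sum-truncate (suc N) (suc k) _ (s≤s k≤N) beyond)
  where
  beyond : ∀ v → suc k ≤ v → v < suc N → δ (suc u ℕ.* v) k * c v ≡ 0ℚ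
  beyond v k<v _ = trans (cong (_* c v) (δ-> (suc u ℕ.* v) k (ℕP.<-≤-trans k<v (ℕP.m≤n*m v (suc u))))) (*-zeroˡ (c v))

dilate-cong : ∀ u {c c′ : ℕ → ℚ} → (∀ m → c m ≡ c′ m) → dilate u c ≗ dilate u c′
dilate-cong u eq k = Sum-cong-≗ (suc k) (λ v → cong (δ (u ℕ.* v) k *_) (eq v))

dilate-·ˡ : ∀ u (c h : Series) n → (dilate (suc u) c · h) n ≡ Sum (suc n) (λ v → c v * (if suc u ℕ.* v ≤ᵇ n then h (n ∸ suc u ℕ.* v) else 0ℚ))
dilate-·ˡ u c h n = begin
  (dilate U c · h) n
    ≡⟨ ·-as-Sum (dilate U c) h n ⟩
  Sum (suc n) (λ k → dilate U c k * h (n ∸ k))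
    ≡⟨ Sum-cong (suc n) (λ k k<1+n → trans (cong (_* h (n ∸ k)) (dilate-extend u c k n (ℕP.≤-pred k<1+n)))
                                           (*-distribʳ-Sum (suc n) _ _)) ⟩
  Sum (suc n) (λ k → Sum (suc n) (λ v → δ (U ℕ.* v) k * c v * h (n ∸ k)))
    ≡⟨ Sum-comm (suc n) (suc n) _ ⟩
  Sum (suc n) (λ v → Sum (suc n) (λ k → δ (U ℕ.* v) k * c v * h (n ∸ k)))
    ≡⟨ Sum-cong-≗ (suc n) column ⟩
  Sum (suc n) (λ v → c v * (if U ℕ.* v ≤ᵇ n then h (n ∸ U ℕ.* v) else 0ℚ)) ∎
  where
  U = suc u
  column : ∀ v → Sum (suc n) (λ k → δ (U ℕ.* v) k * c v * h (n ∸ k)) ≡ c v * (if U ℕ.* v ≤ᵇ n then h (n ∸ U ℕ.* v) else 0ℚ)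
  column v = begin
    Sum (suc n) (λ k → δ (U ℕ.* v) k * c v * h (n ∸ k))
      ≡⟨ Sum-cong-≗ (suc n) (λ k → solve 3 (λ a b e → a :* b :* e := b :* (a :* e)) refl (δ (U ℕ.* v) k) (c v) (h (n ∸ k))) ⟩
    Sum (suc n) (λ k → c v * (δ (U ℕ.* v) k * h (n ∸ k)))
      ≡⟨ *-distribˡ-Sum (suc n) (c v) _ ⟨
    c v * Sum (suc n) (λ k → δ (U ℕ.* v) k * h (n ∸ k))
      ≡⟨ cong (c v *_) (Sum-δ-∸ n (U ℕ.* v) h) ⟩
    c v * (if U ℕ.* v ≤ᵇ n then h (n ∸ U ℕ.* v) else 0ℚ) ∎

δ-+-> : ∀ a b n → n < a → δ (a ℕ.+ b) n ≡ 0ℚ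
δ-+-> a b n n<a = δ-> (a ℕ.+ b) n (ℕP.<-≤-trans n<a (ℕP.m≤m+n a b))

·-as-δ-double-sum : ∀ n (c d : Series) m → m ≤ n →
  Sum (suc n) (λ v → Sum (suc n) (λ w → δ (v ℕ.+ w) m * (c v * d w))) ≡ (c · d) m
·-as-δ-double-sum n c d m m≤n = begin
  Sum (suc n) (λ v → Sum (suc n) (λ w → δ (v ℕ.+ w) m * (c v * d w)))  ≡⟨ Sum-cong-≗ (suc n) row ⟩
  Sum (suc n) (λ v → if v ≤ᵇ m then c v * d (m ∸ v) else 0ℚ)          ≡⟨ Sum-truncate (suc n) (suc m) _ (s≤s m≤n) (λ v m<v _ → if-≤ᵇ-> _ 0ℚ m<v) ⟩
  Sum (suc m) (λ v → if v ≤ᵇ m then c v * d (m ∸ v) else 0ℚ)          ≡⟨ Sum-cong (suc m) (λ v v<1+m → if-≤ᵇ-≤ _ 0ℚ (ℕP.≤-pred v<1+m)) ⟩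
  Sum (suc m) (λ v → c v * d (m ∸ v))                                 ≡⟨ ·-as-Sum c d m ⟨
  (c · d) m                                                           ∎
  where
  row : ∀ v → Sum (suc n) (λ w → δ (v ℕ.+ w) m * (c v * d w)) ≡ (if v ≤ᵇ m then c v * d (m ∸ v) else 0ℚ)
  row v with v ℕ.≤? m
  ... | yes v≤m = begin
    Sum (suc n) (λ w → δ (v ℕ.+ w) m * (c v * d w))  ≡⟨ Sum-cong-≗ (suc n) (λ w → cong (_* (c v * d w)) (trans (sym (δ-∸ v w m v≤m)) (δ-sym w (m ∸ v)))) ⟩
    Sum (suc n) (λ w → δ (m ∸ v) w * (c v * d w))    ≡⟨ Sum-δ (suc n) (m ∸ v) _ (s≤s (ℕP.≤-trans (ℕP.m∸n≤m m v) m≤n)) ⟩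
    c v * d (m ∸ v)                                  ≡⟨ if-≤ᵇ-≤ _ 0ℚ v≤m ⟨
    (if v ≤ᵇ m then c v * d (m ∸ v) else 0ℚ)         ∎
  ... | no v≰m = trans (Sum-zeros (suc n) _ (λ w _ → trans (cong (_* (c v * d w)) (δ-+-> v w m (ℕP.≰⇒> v≰m))) (*-zeroˡ (c v * d w))))
                       (sym (if-≤ᵇ-> _ 0ℚ (ℕP.≰⇒> v≰m)))

module _ (u : ℕ) (c d : Series) (n : ℕ) where
  private
    U = suc u

    dilated-term : ℕ → ℕ → ℚ
    dilated-term v w = δ (U ℕ.* v ℕ.+ U ℕ.* w) n * (c v * d w)

    ·-dilate-row : ∀ v → c v * (if U ℕ.* v ≤ᵇ n then dilate U d (n ∸ U ℕ.* v) else 0ℚ) ≡ Sum (suc n) (dilated-term v)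
    ·-dilate-row v with U ℕ.* v ℕ.≤? n
    ... | yes Uv≤n = begin
      c v * (if U ℕ.* v ≤ᵇ n then dilate U d (n ∸ U ℕ.* v) else 0ℚ)  ≡⟨ cong (c v *_) (if-≤ᵇ-≤ _ 0ℚ Uv≤n) ⟩
      c v * dilate U d (n ∸ U ℕ.* v)                                 ≡⟨ cong (c v *_) (dilate-extend u d (n ∸ U ℕ.* v) n (ℕP.m∸n≤m n (U ℕ.* v))) ⟩
      c v * Sum (suc n) (λ w → δ (U ℕ.* w) (n ∸ U ℕ.* v) * d w)      ≡⟨ *-distribˡ-Sum (suc n) (c v) _ ⟩
      Sum (suc n) (λ w → c v * (δ (U ℕ.* w) (n ∸ U ℕ.* v) * d w))    ≡⟨ Sum-cong-≗ (suc n) term ⟩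
      Sum (suc n) (dilated-term v)                                   ∎
      where
      term : ∀ w → c v * (δ (U ℕ.* w) (n ∸ U ℕ.* v) * d w) ≡ dilated-term v w
      term w = trans (solve 3 (λ C D E → C :* (D :* E) := D :* (C :* E)) refl (c v) (δ (U ℕ.* w) (n ∸ U ℕ.* v)) (d w))
                     (cong (_* (c v * d w)) (δ-∸ (U ℕ.* v) (U ℕ.* w) n Uv≤n))
    ... | no Uv≰n = begin
      c v * (if U ℕ.* v ≤ᵇ n then dilate U d (n ∸ U ℕ.* v) else 0ℚ)  ≡⟨ cong (c v *_) (if-≤ᵇ-> _ 0ℚ (ℕP.≰⇒> Uv≰n)) ⟩
      c v * 0ℚ                                                       ≡⟨ *-zeroʳ (c v) ⟩
      0ℚ                                                             ≡⟨ Sum-zeros (suc n) _ vanish ⟨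
      Sum (suc n) (dilated-term v)                                   ∎
      where
      vanish : ∀ w → w < suc n → dilated-term v w ≡ 0ℚ
      vanish w _ = trans (cong (_* (c v * d w)) (δ-+-> (U ℕ.* v) (U ℕ.* w) n (ℕP.≰⇒> Uv≰n))) (*-zeroˡ (c v * d w))

    collapse-m : ∀ v w → Sum (suc n) (λ m → δ (U ℕ.* m) n * (δ (v ℕ.+ w) m * (c v * d w))) ≡ dilated-term v w
    collapse-m v w = begin
      Sum (suc n) (λ m → δ (U ℕ.* m) n * (δ (v ℕ.+ w) m * (c v * d w)))
        ≡⟨ Sum-cong-≗ (suc n) (λ m → solve 3 (λ A B X → A :* (B :* X) := B :* (A :* X)) refl (δ (U ℕ.* m) n) (δ (v ℕ.+ w) m) (c v * d w)) ⟩
      Sum (suc n) (λ m → δ (v ℕ.+ w) m * (δ (U ℕ.* m) n * (c v * d w)))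
        ≡⟨ collapse (v ℕ.+ w ℕ.≤? n) ⟩
      δ (U ℕ.* (v ℕ.+ w)) n * (c v * d w)
        ≡⟨ cong (λ z → δ z n * (c v * d w)) (ℕP.*-distribˡ-+ U v w) ⟩
      dilated-term v w ∎
      where
      collapse : Dec (v ℕ.+ w ≤ n) → Sum (suc n) (λ m → δ (v ℕ.+ w) m * (δ (U ℕ.* m) n * (c v * d w))) ≡ δ (U ℕ.* (v ℕ.+ w)) n * (c v * d w)
      collapse (yes v+w≤n) = Sum-δ (suc n) (v ℕ.+ w) _ (s≤s v+w≤n)
      collapse (no v+w≰n) = trans (Sum-δ-≥ (suc n) (v ℕ.+ w) _ (ℕP.≰⇒> v+w≰n))
        (sym (trans (cong (_* (c v * d w)) (δ-> (U ℕ.* (v ℕ.+ w)) n (ℕP.<-≤-trans (ℕP.≰⇒> v+w≰n) (ℕP.m≤n*m (v ℕ.+ w) U)))) (*-zeroˡ (c v * d w))))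

  dilate-· : (dilate U c · dilate U d) n ≡ dilate U (c · d) n
  dilate-· = begin
    (dilate U c · dilate U d) n
      ≡⟨ dilate-·ˡ u c (dilate U d) n ⟩
    Sum (suc n) (λ v → c v * (if U ℕ.* v ≤ᵇ n then dilate U d (n ∸ U ℕ.* v) else 0ℚ))
      ≡⟨ Sum-cong-≗ (suc n) ·-dilate-row ⟩
    Sum (suc n) (λ v → Sum (suc n) (dilated-term v))
      ≡⟨ Sum-cong-≗ (suc n) (λ v → Sum-cong-≗ (suc n) (collapse-m v)) ⟨
    Sum (suc n) (λ v → Sum (suc n) (λ w → Sum (suc n) (λ m → δ (U ℕ.* m) n * (δ (v ℕ.+ w) m * (c v * d w)))))
      ≡⟨ Sum-cong-≗ (suc n) (λ v → Sum-comm (suc n) (suc n) _) ⟨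
    Sum (suc n) (λ v → Sum (suc n) (λ m → Sum (suc n) (λ w → δ (U ℕ.* m) n * (δ (v ℕ.+ w) m * (c v * d w)))))
      ≡⟨ Sum-comm (suc n) (suc n) _ ⟩
    Sum (suc n) (λ m → Sum (suc n) (λ v → Sum (suc n) (λ w → δ (U ℕ.* m) n * (δ (v ℕ.+ w) m * (c v * d w)))))
      ≡⟨ Sum-cong-≗ (suc n) (λ m → trans (Sum-cong-≗ (suc n) (λ v → sym (*-distribˡ-Sum (suc n) (δ (U ℕ.* m) n) _))) (sym (*-distribˡ-Sum (suc n) (δ (U ℕ.* m) n) _))) ⟩
    Sum (suc n) (λ m → δ (U ℕ.* m) n * Sum (suc n) (λ v → Sum (suc n) (λ w → δ (v ℕ.+ w) m * (c v * d w))))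
      ≡⟨ Sum-cong (suc n) (λ m m<1+n → cong (δ (U ℕ.* m) n *_) (·-as-δ-double-sum n c d m (ℕP.≤-pred m<1+n))) ⟩
    Sum (suc n) (λ m → δ (U ℕ.* m) n * (c · d) m)
      ≡⟨ dilate-extend u (c · d) n n ℕP.≤-refl ⟨
    dilate U (c · d) n ∎

dilate-evalLCA : ∀ u ls (G : ℕ → Series) k → dilate u (λ m → evalLCA ls (λ l → G l m)) k ≡ evalLCA ls (λ l → dilate u (G l) k)
dilate-evalLCA u [] G k = Sum-zeros (suc k) _ (λ v _ → *-zeroʳ (δ (u ℕ.* v) k))
dilate-evalLCA u ((c , l) ∷ ls) G k = begin
  Sum (suc k) (λ v → δ (u ℕ.* v) k * (c * G l v + evalLCA ls (λ l′ → G l′ v)))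
    ≡⟨ Sum-cong-≗ (suc k) (λ v → solve 4 (λ D C X Y → D :* (C :* X :+ Y) := C :* (D :* X) :+ D :* Y) refl (δ (u ℕ.* v) k) c (G l v) (evalLCA ls (λ l′ → G l′ v))) ⟩
  Sum (suc k) (λ v → c * (δ (u ℕ.* v) k * G l v) + δ (u ℕ.* v) k * evalLCA ls (λ l′ → G l′ v))
    ≡⟨ Sum-distrib-+ (suc k) _ _ ⟩
  Sum (suc k) (λ v → c * (δ (u ℕ.* v) k * G l v)) + dilate u (λ m → evalLCA ls (λ l′ → G l′ m)) k
    ≡⟨ cong₂ _+_ (sym (*-distribˡ-Sum (suc k) c _)) (dilate-evalLCA u ls G k) ⟩
  c * dilate u (G l) k + evalLCA ls (λ l′ → dilate u (G l′) k) ∎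

letterSeries : ℕ → ℕ → Series
letterSeries s u = dilate u (letterWeight s)

letterSeries-·-⋄ : ∀ a b u → 1 ≤ a → 1 ≤ b → ∀ n → (letterSeries a (suc u) · letterSeries b (suc u)) n ≡ evalLCA (a ⋄ b) (λ l → letterSeries l (suc u) n)
letterSeries-·-⋄ a b u 1≤a 1≤b n = begin
  (letterSeries a (suc u) · letterSeries b (suc u)) n                ≡⟨ dilate-· u (letterWeight a) (letterWeight b) n ⟩
  dilate (suc u) (letterWeight a · letterWeight b) n                 ≡⟨ dilate-cong (suc u) (letterWeight-·-⋄ a b 1≤a 1≤b) n ⟩
  dilate (suc u) (λ m → evalLCA (a ⋄ b) (λ l → letterWeight l m)) n  ≡⟨ dilate-evalLCA (suc u) (a ⋄ b) letterWeight n ⟩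
  evalLCA (a ⋄ b) (λ l → letterSeries l (suc u) n)                   ∎

-- Truncated brackets and the quasi-shuffle product

evalLC : (Word → Series) → LC → Series
evalLC E [] n = 0ℚ
evalLC E ((c , u) ∷ x) n = c * E u n + evalLC E x n

evalLC-++ : ∀ E x y → evalLC E (x ++ y) ≗ λ n → evalLC E x n + evalLC E y n
evalLC-++ E [] y n = sym (+-identityˡ _)
evalLC-++ E ((c , u) ∷ x) y n = trans (cong (c * E u n +_) (evalLC-++ E x y n)) (sym (+-assoc (c * E u n) _ _))

evalLC-prefix : ∀ E a x → evalLC E (prefix a x) ≗ evalLC (λ u → E (a ∷ u)) x
evalLC-prefix E a [] n = refl
evalLC-prefix E a ((c , u) ∷ x) n = cong (c * E (a ∷ u) n +_) (evalLC-prefix E a x n)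

evalLC-scaledPrefix : ∀ E c l x → evalLC E (map (λ { (d , u) → (c * d , l ∷ u) }) x) ≗ λ n → c * evalLC (λ u → E (l ∷ u)) x n
evalLC-scaledPrefix E c l [] n = sym (*-zeroʳ c)
evalLC-scaledPrefix E c l ((d , u) ∷ x) n = begin
  c * d * E (l ∷ u) n + evalLC E (map (λ { (d , u) → (c * d , l ∷ u) }) x) n ≡⟨ cong (c * d * E (l ∷ u) n +_) (evalLC-scaledPrefix E c l x n) ⟩
  c * d * E (l ∷ u) n + c * evalLC (λ u → E (l ∷ u)) x n                  ≡⟨ solve 4 (λ C D X Y → C :* D :* X :+ C :* Y := C :* (D :* X :+ Y)) refl c d (E (l ∷ u) n) (evalLC (λ u → E (l ∷ u)) x n) ⟩
  c * (d * E (l ∷ u) n + evalLC (λ u → E (l ∷ u)) x n)                    ∎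

evalLC-letterTimes : ∀ E ls x → evalLC E (letterTimes ls x) ≗ λ n → evalLCA ls (λ l → evalLC (λ u → E (l ∷ u)) x n)
evalLC-letterTimes E [] x n = refl
evalLC-letterTimes E ((c , l) ∷ ls) x n = begin
  evalLC E (map (λ { (d , u) → (c * d , l ∷ u) }) x ++ letterTimes ls x) n
    ≡⟨ evalLC-++ E (map (λ { (d , u) → (c * d , l ∷ u) }) x) _ n ⟩
  evalLC E (map (λ { (d , u) → (c * d , l ∷ u) }) x) n + evalLC E (letterTimes ls x) n
    ≡⟨ cong₂ _+_ (evalLC-scaledPrefix E c l x n) (evalLC-letterTimes E ls x n) ⟩
  c * evalLC (λ u → E (l ∷ u)) x n + evalLCA ls (λ l → evalLC (λ u → E (l ∷ u)) x n) ∎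

evalLC-cong : ∀ {E E′ : Word → Series} x n → (∀ u → E u n ≡ E′ u n) → evalLC E x n ≡ evalLC E′ x n
evalLC-cong [] n eq = refl
evalLC-cong ((c , u) ∷ x) n eq = cong₂ (λ a b → c * a + b) (eq u) (evalLC-cong x n eq)

evalLC-zero : ∀ E x n → (∀ u → E u n ≡ 0ℚ) → evalLC E x n ≡ 0ℚ
evalLC-zero E [] n eq = refl
evalLC-zero E ((c , u) ∷ x) n eq = trans (cong₂ (λ a b → c * a + b) (eq u) (evalLC-zero E x n eq)) (solve 1 (λ c → c :* con 0ℚ :+ con 0ℚ := con 0ℚ) refl c)

evalLC-·ˡ : ∀ (f : Series) E x → evalLC (λ u → f · E u) x ≗ f · evalLC E x
evalLC-·ˡ f E [] n = sym (trans (·-comm f (λ k → 0ℚ) n) (·-zeroˡ (λ k → 0ℚ) f (λ k → refl) n))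
evalLC-·ˡ f E ((c , u) ∷ x) n = begin
  c * (f · E u) n + evalLC (λ u → f · E u) x n            ≡⟨ cong₂ _+_ (sym (*-·ʳ c f (E u) n)) (evalLC-·ˡ f E x n) ⟩
  (f · (λ k → c * E u k)) n + (f · evalLC E x) n          ≡⟨ ·-distribˡ-+ f (λ k → c * E u k) (evalLC E x) n ⟨
  (f · (λ k → c * E u k + evalLC E x k)) n                ∎

evalLCA-·ʳ : ∀ ls (Fs : ℕ → Series) (G : Series) n → evalLCA ls (λ l → (Fs l · G) n) ≡ ((λ k → evalLCA ls (λ l → Fs l k)) · G) n
evalLCA-·ʳ [] Fs G n = sym (·-zeroˡ (λ k → 0ℚ) G (λ k → refl) n)
evalLCA-·ʳ ((c , l) ∷ ls) Fs G n = begin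
  c * (Fs l · G) n + evalLCA ls (λ l → (Fs l · G) n)                      ≡⟨ cong₂ _+_ (sym (*-·ˡ c (Fs l) G n)) (evalLCA-·ʳ ls Fs G n) ⟩
  ((λ k → c * Fs l k) · G) n + ((λ k → evalLCA ls (λ l → Fs l k)) · G) n  ≡⟨ ·-distribʳ-+ (λ k → c * Fs l k) (λ k → evalLCA ls (λ l → Fs l k)) G n ⟨
  ((λ k → c * Fs l k + evalLCA ls (λ l → Fs l k)) · G) n                  ∎

-- the bracket with its outermost summation variable restricted to u₁ ≤ ub
truncBracket : ℕ → Word → Series
truncBracket ub [] = 𝟙
truncBracket zero (s ∷ w) _ = 0ℚ
truncBracket (suc ub) (s ∷ w) n = truncBracket ub (s ∷ w) n + (letterSeries s (suc ub) · truncBracket ub w) n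

truncBracketStep : ℕ → Word → Series
truncBracketStep ub [] _ = 0ℚ
truncBracketStep ub (s ∷ w) = letterSeries s (suc ub) · truncBracket ub w

evalLC-truncBracket-suc : ∀ ub x → evalLC (truncBracket (suc ub)) x ≗ λ n → evalLC (truncBracket ub) x n + evalLC (truncBracketStep ub) x n
evalLC-truncBracket-suc ub [] n = sym (+-identityʳ 0ℚ)
evalLC-truncBracket-suc ub ((c , u) ∷ x) n = begin
  c * truncBracket (suc ub) u n + evalLC (truncBracket (suc ub)) x n
    ≡⟨ cong₂ (λ a b → c * a + b) (step u) (evalLC-truncBracket-suc ub x n) ⟩
  c * (truncBracket ub u n + truncBracketStep ub u n) + (evalLC (truncBracket ub) x n + evalLC (truncBracketStep ub) x n)
    ≡⟨ solve 5 (λ C A B X Y → C :* (A :+ B) :+ (X :+ Y) := C :* A :+ X :+ (C :* B :+ Y)) refl c (truncBracket ub u n) (truncBracketStep ub u n) (evalLC (truncBracket ub) x n) (evalLC (truncBracketStep ub) x n) ⟩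
  c * truncBracket ub u n + evalLC (truncBracket ub) x n + (c * truncBracketStep ub u n + evalLC (truncBracketStep ub) x n) ∎
  where
  step : ∀ u → truncBracket (suc ub) u n ≡ truncBracket ub u n + truncBracketStep ub u n
  step [] = sym (+-identityʳ _)
  step (s ∷ u) = refl

evalLC-⋆-cons : ∀ E a b w v → evalLC E ((a ∷ w) ⋆ (b ∷ v)) ≗ λ n →
  evalLC (λ u → E (a ∷ u)) (w ⋆ (b ∷ v)) n + (evalLC (λ u → E (b ∷ u)) ((a ∷ w) ⋆ v) n + evalLCA (a ⋄ b) (λ l → evalLC (λ u → E (l ∷ u)) (w ⋆ v) n))
evalLC-⋆-cons E a b w v n = begin
  evalLC E (prefix a X ++ prefix b Y ++ letterTimes (a ⋄ b) Z) n
    ≡⟨ evalLC-++ E (prefix a X) _ n ⟩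
  evalLC E (prefix a X) n + evalLC E (prefix b Y ++ letterTimes (a ⋄ b) Z) n
    ≡⟨ cong (evalLC E (prefix a X) n +_) (evalLC-++ E (prefix b Y) _ n) ⟩
  evalLC E (prefix a X) n + (evalLC E (prefix b Y) n + evalLC E (letterTimes (a ⋄ b) Z) n)
    ≡⟨ cong₂ _+_ (evalLC-prefix E a X n) (cong₂ _+_ (evalLC-prefix E b Y n) (evalLC-letterTimes E (a ⋄ b) Z n)) ⟩
  evalLC (λ u → E (a ∷ u)) X n + (evalLC (λ u → E (b ∷ u)) Y n + evalLCA (a ⋄ b) (λ l → evalLC (λ u → E (l ∷ u)) Z n)) ∎
  where
  X = w ⋆ (b ∷ v)
  Y = (a ∷ w) ⋆ v
  Z = w ⋆ v

evalLC-truncBracketStep-⋆ : ∀ ub a b w v →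
  evalLC (truncBracketStep ub) ((a ∷ w) ⋆ (b ∷ v)) ≗ λ n →
    (letterSeries a (suc ub) · evalLC (truncBracket ub) (w ⋆ (b ∷ v))) n
    + ((letterSeries b (suc ub) · evalLC (truncBracket ub) ((a ∷ w) ⋆ v)) n
    + ((λ k → evalLCA (a ⋄ b) (λ l → letterSeries l (suc ub) k)) · evalLC (truncBracket ub) (w ⋆ v)) n)
evalLC-truncBracketStep-⋆ ub a b w v n = trans (evalLC-⋆-cons (truncBracketStep ub) a b w v n)
  (cong₂ _+_ (prefixed a (w ⋆ (b ∷ v))) (cong₂ _+_ (prefixed b ((a ∷ w) ⋆ v)) diamond))
  where
  Q = truncBracket ub
  prefixed : ∀ a x → evalLC (λ u → truncBracketStep ub (a ∷ u)) x n ≡ (letterSeries a (suc ub) · evalLC Q x) n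
  prefixed a x = evalLC-·ˡ (letterSeries a (suc ub)) Q x n
  diamond : evalLCA (a ⋄ b) (λ l → evalLC (λ u → truncBracketStep ub (l ∷ u)) (w ⋆ v) n)
          ≡ ((λ k → evalLCA (a ⋄ b) (λ l → letterSeries l (suc ub) k)) · evalLC Q (w ⋆ v)) n
  diamond = trans (evalLCA-cong (a ⋄ b) (λ l → prefixed l (w ⋆ v))) (evalLCA-·ʳ (a ⋄ b) (λ l → letterSeries l (suc ub)) (evalLC Q (w ⋆ v)) n)

·-expand : ∀ (A B F G P Q : Series) n →
  ((λ k → A k + (F · P) k) · (λ k → B k + (G · Q) k)) n
    ≡ (A · B) n + ((F · (P · B)) n + ((G · (A · Q)) n + ((F · G) · (P · Q)) n))
·-expand A B F G P Q n = begin
  ((λ k → A k + (F · P) k) · B′) n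
    ≡⟨ ·-distribʳ-+ A (F · P) B′ n ⟩
  (A · B′) n + ((F · P) · B′) n
    ≡⟨ cong₂ _+_ (·-distribˡ-+ A B (G · Q) n) (·-distribˡ-+ (F · P) B (G · Q) n) ⟩
  (A · B) n + (A · (G · Q)) n + (((F · P) · B) n + ((F · P) · (G · Q)) n)
    ≡⟨ cong₂ (λ x y → (A · B) n + x + y) (·-exchange A G Q n) (cong₂ _+_ (·-assoc F P B n) FP·GQ) ⟩
  (A · B) n + (G · (A · Q)) n + ((F · (P · B)) n + ((F · G) · (P · Q)) n)
    ≡⟨ solve 4 (λ a b c d → a :+ c :+ (b :+ d) := a :+ (b :+ (c :+ d))) refl ((A · B) n) ((F · (P · B)) n) ((G · (A · Q)) n) (((F · G) · (P · Q)) n) ⟩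
  (A · B) n + ((F · (P · B)) n + ((G · (A · Q)) n + ((F · G) · (P · Q)) n)) ∎
  where
  B′ = λ k → B k + (G · Q) k
  FP·GQ : ((F · P) · (G · Q)) n ≡ ((F · G) · (P · Q)) n
  FP·GQ = begin
    ((F · P) · (G · Q)) n  ≡⟨ ·-assoc F P (G · Q) n ⟩
    (F · (P · (G · Q))) n  ≡⟨ ·-congʳ F n (λ k _ → ·-exchange P G Q k) ⟩
    (F · (G · (P · Q))) n  ≡⟨ ·-assoc F G (P · Q) n ⟨
    ((F · G) · (P · Q)) n  ∎

truncBracket-⋆ : ∀ ub w v → All (1 ≤_) w → All (1 ≤_) v → evalLC (truncBracket ub) (w ⋆ v) ≗ truncBracket ub w · truncBracket ub v
truncBracket-⋆ ub [] v _ _ n = trans (solve 1 (λ x → con 1ℚ :* x :+ con 0ℚ := x) refl (truncBracket ub v n)) (sym (·-identityˡ (truncBracket ub v) n))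
truncBracket-⋆ ub (a ∷ w) [] _ _ n = trans (solve 1 (λ x → con 1ℚ :* x :+ con 0ℚ := x) refl (truncBracket ub (a ∷ w) n)) (sym (·-identityʳ (truncBracket ub (a ∷ w)) n))
truncBracket-⋆ zero (a ∷ w) (b ∷ v) _ _ n = begin
  evalLC (truncBracket 0) ((a ∷ w) ⋆ (b ∷ v)) n
    ≡⟨ evalLC-⋆-cons (truncBracket 0) a b w v n ⟩
  evalLC (λ u → truncBracket 0 (a ∷ u)) (w ⋆ (b ∷ v)) n + (evalLC (λ u → truncBracket 0 (b ∷ u)) ((a ∷ w) ⋆ v) n
    + evalLCA (a ⋄ b) (λ l → evalLC (λ u → truncBracket 0 (l ∷ u)) (w ⋆ v) n))
    ≡⟨ cong₂ _+_ (evalLC-zero _ (w ⋆ (b ∷ v)) n (λ _ → refl)) (cong₂ _+_ (evalLC-zero _ ((a ∷ w) ⋆ v) n (λ _ → refl))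
         (evalLCA-zero (a ⋄ b) _ (λ l → evalLC-zero _ (w ⋆ v) n (λ _ → refl)))) ⟩
  0ℚ + (0ℚ + 0ℚ)
    ≡⟨ ·-zeroˡ (truncBracket 0 (a ∷ w)) (truncBracket 0 (b ∷ v)) (λ _ → refl) n ⟨
  (truncBracket 0 (a ∷ w) · truncBracket 0 (b ∷ v)) n ∎
truncBracket-⋆ (suc ub) (a ∷ w) (b ∷ v) (1≤a ∷ hw) (1≤b ∷ hv) n = begin
  evalLC (truncBracket (suc ub)) ((a ∷ w) ⋆ (b ∷ v)) n
    ≡⟨ evalLC-truncBracket-suc ub ((a ∷ w) ⋆ (b ∷ v)) n ⟩
  evalLC Q ((a ∷ w) ⋆ (b ∷ v)) n + evalLC (truncBracketStep ub) ((a ∷ w) ⋆ (b ∷ v)) n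
    ≡⟨ cong₂ _+_ (truncBracket-⋆ ub (a ∷ w) (b ∷ v) (1≤a ∷ hw) (1≤b ∷ hv) n) (evalLC-truncBracketStep-⋆ ub a b w v n) ⟩
  (QA · QB) n + ((Fa · evalLC Q (w ⋆ (b ∷ v))) n + ((Fb · evalLC Q ((a ∷ w) ⋆ v)) n + (Fab · evalLC Q (w ⋆ v)) n))
    ≡⟨ cong ((QA · QB) n +_) (cong₂ _+_ (·-congʳ Fa n (λ k _ → truncBracket-⋆ ub w (b ∷ v) hw (1≤b ∷ hv) k))
         (cong₂ _+_ (·-congʳ Fb n (λ k _ → truncBracket-⋆ ub (a ∷ w) v (1≤a ∷ hw) hv k))
           (trans (·-congˡ (evalLC Q (w ⋆ v)) n (λ k _ → sym (letterSeries-·-⋄ a b ub 1≤a 1≤b k)))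
                  (·-congʳ (Fa · Fb) n (λ k _ → truncBracket-⋆ ub w v hw hv k))))) ⟩
  (QA · QB) n + ((Fa · (Q w · QB)) n + ((Fb · (QA · Q v)) n + ((Fa · Fb) · (Q w · Q v)) n))
    ≡⟨ ·-expand QA QB Fa Fb (Q w) (Q v) n ⟨
  (truncBracket (suc ub) (a ∷ w) · truncBracket (suc ub) (b ∷ v)) n ∎
  where
  Q = truncBracket ub
  QA = Q (a ∷ w)
  QB = Q (b ∷ v)
  Fa = letterSeries a (suc ub)
  Fb = letterSeries b (suc ub)
  Fab = λ k → evalLCA (a ⋄ b) (λ l → letterSeries l (suc ub) k)

-- Truncated brackets are brackets in low degrees

bracketCoeff : Word → ℚ
bracketCoeff = foldr (λ t acc → invFact (t ∸ 1) * acc) 1ℚ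

sigmaTerm : ℕ → List ℕ → ℕ → ℕ → ℕ
sigmaTerm r rs n u = sumℕ (map (λ v → if u ℕ.* v ≤ᵇ n then (v ^ r) ℕ.* sigma' rs (n ∸ u ℕ.* v) u else 0) (range1 n))

fromℕ-sigma'-suc : ∀ r rs n ub → fromℕ (sigma' (r ∷ rs) n (suc (suc ub))) ≡ fromℕ (sigma' (r ∷ rs) n (suc ub)) + fromℕ (sigmaTerm r rs n (suc ub))
fromℕ-sigma'-suc r rs n ub = begin
  fromℕ (sigma' (r ∷ rs) n (suc (suc ub)))                  ≡⟨ fromℕ-sumℕ-range1 (suc ub) (sigmaTerm r rs n) ⟩
  Sum ub (λ i → fromℕ (sigmaTerm r rs n (suc i))) + fromℕ (sigmaTerm r rs n (suc ub))
                                                            ≡⟨ cong (_+ fromℕ (sigmaTerm r rs n (suc ub))) (fromℕ-sumℕ-range1 ub (sigmaTerm r rs n)) ⟨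
  fromℕ (sigma' (r ∷ rs) n (suc ub)) + fromℕ (sigmaTerm r rs n (suc ub)) ∎

letterSeries-·-sigma : ∀ s ub w n → (∀ m → truncBracket ub w m ≡ bracketCoeff w * fromℕ (sigma' (map (_∸ 1) w) m (suc ub))) →
  (letterSeries s (suc ub) · truncBracket ub w) n ≡ bracketCoeff (s ∷ w) * fromℕ (sigmaTerm (s ∸ 1) (map (_∸ 1) w) n (suc ub))
letterSeries-·-sigma s ub w n tail≡sigma = begin
  (letterSeries s U · truncBracket ub w) n
    ≡⟨ dilate-·ˡ ub (letterWeight s) (truncBracket ub w) n ⟩
  Sum (suc n) (λ v → letterWeight s v * (if U ℕ.* v ≤ᵇ n then truncBracket ub w (n ∸ U ℕ.* v) else 0ℚ))
    ≡⟨ Sum-head-0 n _ (*-zeroˡ (if U ℕ.* 0 ≤ᵇ n then truncBracket ub w (n ∸ U ℕ.* 0) else 0ℚ)) ⟩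
  Sum n (λ i → letterWeight s (suc i) * (if U ℕ.* suc i ≤ᵇ n then truncBracket ub w (n ∸ U ℕ.* suc i) else 0ℚ))
    ≡⟨ Sum-cong-≗ n term ⟩
  Sum n (λ i → invFact r * bracketCoeff w * fromℕ (if U ℕ.* suc i ≤ᵇ n then (suc i ^ r) ℕ.* sigma' rs (n ∸ U ℕ.* suc i) U else 0))
    ≡⟨ *-distribˡ-Sum n (invFact r * bracketCoeff w) _ ⟨
  invFact r * bracketCoeff w * Sum n (λ i → fromℕ (if U ℕ.* suc i ≤ᵇ n then (suc i ^ r) ℕ.* sigma' rs (n ∸ U ℕ.* suc i) U else 0))
    ≡⟨ cong (invFact r * bracketCoeff w *_) (fromℕ-sumℕ-range1 n _) ⟨
  bracketCoeff (s ∷ w) * fromℕ (sigmaTerm r rs n U) ∎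
  where
  r = s ∸ 1
  rs = map (_∸ 1) w
  U = suc ub
  term : ∀ i → letterWeight s (suc i) * (if U ℕ.* suc i ≤ᵇ n then truncBracket ub w (n ∸ U ℕ.* suc i) else 0ℚ)
             ≡ invFact r * bracketCoeff w * fromℕ (if U ℕ.* suc i ≤ᵇ n then (suc i ^ r) ℕ.* sigma' rs (n ∸ U ℕ.* suc i) U else 0)
  term i with U ℕ.* suc i ≤ᵇ n
  ... | true = begin
    fromℕ (suc i ^ r) * invFact r * truncBracket ub w (n ∸ U ℕ.* suc i)
      ≡⟨ cong (fromℕ (suc i ^ r) * invFact r *_) (tail≡sigma (n ∸ U ℕ.* suc i)) ⟩
    fromℕ (suc i ^ r) * invFact r * (bracketCoeff w * fromℕ (sigma' rs (n ∸ U ℕ.* suc i) U))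
      ≡⟨ solve 4 (λ A B C D → A :* B :* (C :* D) := B :* C :* (A :* D)) refl (fromℕ (suc i ^ r)) (invFact r) (bracketCoeff w) (fromℕ (sigma' rs (n ∸ U ℕ.* suc i) U)) ⟩
    invFact r * bracketCoeff w * (fromℕ (suc i ^ r) * fromℕ (sigma' rs (n ∸ U ℕ.* suc i) U))
      ≡⟨ cong (invFact r * bracketCoeff w *_) (fromℕ-* (suc i ^ r) _) ⟨
    invFact r * bracketCoeff w * fromℕ ((suc i ^ r) ℕ.* sigma' rs (n ∸ U ℕ.* suc i) U) ∎
  ... | false = trans (*-zeroʳ (letterWeight s (suc i))) (sym (*-zeroʳ (invFact r * bracketCoeff w)))

truncBracket-sigma : ∀ ub w n → truncBracket ub w n ≡ bracketCoeff w * fromℕ (sigma' (map (_∸ 1) w) n (suc ub))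
truncBracket-sigma ub [] zero = refl
truncBracket-sigma ub [] (suc n) = refl
truncBracket-sigma zero (s ∷ w) n = sym (*-zeroʳ (bracketCoeff (s ∷ w)))
truncBracket-sigma (suc ub) (s ∷ w) n = begin
  truncBracket ub (s ∷ w) n + (letterSeries s (suc ub) · truncBracket ub w) n
    ≡⟨ cong₂ _+_ (truncBracket-sigma ub (s ∷ w) n) (letterSeries-·-sigma s ub w n (truncBracket-sigma ub w)) ⟩
  c * fromℕ (sigma' (r ∷ rs) n (suc ub)) + c * fromℕ (sigmaTerm r rs n (suc ub))
    ≡⟨ *-distribˡ-+ c _ _ ⟨
  c * (fromℕ (sigma' (r ∷ rs) n (suc ub)) + fromℕ (sigmaTerm r rs n (suc ub)))
    ≡⟨ cong (c *_) (fromℕ-sigma'-suc r rs n ub) ⟨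
  c * fromℕ (sigma' (r ∷ rs) n (suc (suc ub))) ∎
  where
  c = bracketCoeff (s ∷ w)
  r = s ∸ 1
  rs = map (_∸ 1) w

-- Only u₁ ≤ n contributes to the coefficient of qⁿ.
bracket≡truncBracket : ∀ w n → bracket w n ≡ truncBracket n w n
bracket≡truncBracket [] n = refl
bracket≡truncBracket (s ∷ ss) zero = refl
bracket≡truncBracket (s ∷ ss) (suc n) =
  trans (cong (bracketCoeff (s ∷ ss) *_) (k/1≡fromℕ (sigma (map (_∸ 1) (s ∷ ss)) (suc n)))) (sym (truncBracket-sigma (suc n) (s ∷ ss) (suc n)))

letterSeries-low : ∀ s ub j → j ≤ ub → letterSeries s (suc ub) j ≡ 0ℚ
letterSeries-low s ub j j≤ub = Sum-zeros (suc j) _ vanish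
  where
  vanish : ∀ v → v < suc j → δ (suc ub ℕ.* v) j * letterWeight s v ≡ 0ℚ
  vanish zero _ = *-zeroʳ (δ (suc ub ℕ.* 0) j)
  vanish (suc v) _ = trans (cong (_* letterWeight s (suc v)) (δ-> (suc ub ℕ.* suc v) j (ℕP.<-≤-trans (s≤s j≤ub) (ℕP.m≤m*n (suc ub) (suc v))))) (*-zeroˡ (letterWeight s (suc v)))

truncBracket-suc-low : ∀ ub w k → k ≤ ub → truncBracket (suc ub) w k ≡ truncBracket ub w k
truncBracket-suc-low ub [] k k≤ub = refl
truncBracket-suc-low ub (s ∷ w) k k≤ub = trans (cong (truncBracket ub (s ∷ w) k +_) new-u₁≡0) (+-identityʳ _)
  where
  new-u₁≡0 : (letterSeries s (suc ub) · truncBracket ub w) k ≡ 0ℚ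
  new-u₁≡0 = trans (·-congˡ (truncBracket ub w) k (λ j j≤k → letterSeries-low s ub j (ℕP.≤-trans j≤k k≤ub)))
                   (·-zeroˡ (λ _ → 0ℚ) (truncBracket ub w) (λ _ → refl) k)

truncBracket-stable : ∀ ub k w → k ≤ ub → truncBracket ub w k ≡ truncBracket k w k
truncBracket-stable ub k w k≤ub = trans (cong (λ z → truncBracket z w k) (sym (ℕP.m∸n+n≡m k≤ub))) (from (ub ∸ k))
  where
  from : ∀ d → truncBracket (d ℕ.+ k) w k ≡ truncBracket k w k
  from zero = refl
  from (suc d) = trans (truncBracket-suc-low (d ℕ.+ k) w k (ℕP.m≤n+m k d)) (from d)

bracket≡truncBracket-≥ : ∀ ub k w → k ≤ ub → bracket w k ≡ truncBracket ub w k
bracket≡truncBracket-≥ ub k w k≤ub = trans (bracket≡truncBracket w k) (sym (truncBracket-stable ub k w k≤ub))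

bracketLC≡evalLC : ∀ x → bracketLC x ≗ evalLC bracket x
bracketLC≡evalLC [] n = refl
bracketLC≡evalLC ((c , u) ∷ x) n = cong (c * bracket u n +_) (bracketLC≡evalLC x n)

mainTheorem12 : (w v : Word) → All (1 ≤_) w → All (1 ≤_) v →
    ∀ (n : ℕ) → bracketLC (w ⋆ v) n ≡ (bracket w · bracket v) n
mainTheorem12 w v 1≤w 1≤v n = begin
  bracketLC (w ⋆ v) n                         ≡⟨ bracketLC≡evalLC (w ⋆ v) n ⟩
  evalLC bracket (w ⋆ v) n                    ≡⟨ evalLC-cong (w ⋆ v) n (λ u → bracket≡truncBracket u n) ⟩
  evalLC (truncBracket n) (w ⋆ v) n           ≡⟨ truncBracket-⋆ n w v 1≤w 1≤v n ⟩
  (truncBracket n w · truncBracket n v) n     ≡⟨ ·-congˡ (truncBracket n v) n (λ k k≤n → bracket≡truncBracket-≥ n k w k≤n) ⟨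
  (bracket w · truncBracket n v) n            ≡⟨ ·-congʳ (bracket w) n (λ k k≤n → bracket≡truncBracket-≥ n k v k≤n) ⟨
  (bracket w · bracket v) n                   ∎
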